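{- Let $k>5$ be an integer, $w_k=\Big(\prod_{i=2}^{k-1}{\tt a}{\tt b}^i{\tt a}{\tt a}\cdot{\tt a}{\tt b}^i{\tt a}{\tt b}{\tt a}^{i-2}\Big)\cdot{\tt a}{\tt b}^k{\tt a}$, and write $\beta(x)=\beta(x,w_k\$)$. Then $\beta(\$)={\tt a}$; $\beta({\tt a}\$)={\tt b}$; $\beta({\tt a}^i{\tt b})={\tt b}{\tt a}^{k-i-2}$ for all $4\le i\le k-2$; $\beta({\tt a}^3{\tt b})={\tt b}^5({\tt a}{\tt b})^{k-6}{\tt a}$; $\beta({\tt a}^2{\tt b})={\tt a}{\tt a}{\tt b}{\tt a}^{2k-8}$; $\beta({\tt a}{\tt b})={\tt b}^{k-2}\${\tt a}{\tt b}{\tt a}^{2k-6}$; $\beta({\tt b}{\tt a})={\tt b}{\tt a}^{k-5}{\tt b}{\tt b}{\tt b}{\tt a}{\tt b}^{k-5}{\tt a}{\tt b}^{k-2}{\tt a}$; $\beta({\tt b}^j{\tt a})={\tt b}{\tt a}{\tt b}^{2k-2j-2}{\tt a}$ for all $2\le j\le k-1$; and $\beta({\tt b}^k{\tt a})={\tt a}$. Hence $\mathrm{BWT}(w_k\$)=\beta(\$)\cdot\beta({\tt a}\$)\cdot\prod_{i=2}^{k-1}\beta({\tt a}^{k-i}{\tt b})\cdot\prod_{i=1}^{k}\beta({\tt b}^i{\tt a})$, and the number of runs of $\mathrm{BWT}(w_k\$)$ is $8k-16$.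
   Context: Alphabet $\{\$,{\tt a},{\tt b}\}$ with $\$<{\tt a}<{\tt b}$, where $\$$ is an end-of-string symbol appended to $w_k$; $\prod$ is concatenation in increasing index order. For a word $w$ of length $n$, $\mathrm{BWT}(w)$ is obtained by sorting the conjugates $w[i..n-1]w[0..i-1]$ lexicographically and concatenating their last characters; runs are maximal equal-letter factors. For words $x,w$, $\beta(x,w)$ is the factor of $\mathrm{BWT}(w)$ formed by the last characters of the conjugates of $w$ having $x$ as a prefix (a contiguous range in sorted order). -}

module Defs where

open import Data.Bool using (Bool; true; false; _∧_; _∨_; if_then_else_)
open import Data.Nat using (ℕ; zero; suc; _+_; _∸_)
open import Data.List using (List; []; _∷_; _++_; length; drop; take; map; concat; concatMap; mapMaybe; last; replicate; upTo)
open import Data.Maybe using (Maybe; just; nothing)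

data Sym : Set where
  $ a b : Sym

_<ˢ_ : Sym → Sym → Bool
$ <ˢ a = true
$ <ˢ b = true
a <ˢ b = true
_ <ˢ _ = false

_==ˢ_ : Sym → Sym → Bool
$ ==ˢ $ = true
a ==ˢ a = true
b ==ˢ b = true
_ ==ˢ _ = false

Word : Set
Word = List Sym

_≤ˡ_ : Word → Word → Bool
[] ≤ˡ _ = true
(_ ∷ _) ≤ˡ [] = false
(x ∷ xs) ≤ˡ (y ∷ ys) = (x <ˢ y) ∨ ((x ==ˢ y) ∧ (xs ≤ˡ ys))

insert : Word → List Word → List Word
insert u [] = u ∷ []
insert u (v ∷ vs) = if u ≤ˡ v then u ∷ v ∷ vs else v ∷ insert u vs

sortWords : List Word → List Word
sortWords [] = []
sortWords (u ∷ us) = insert u (sortWords us)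

conj : Word → ℕ → Word
conj w i = drop i w ++ take i w

conjugates : Word → List Word
conjugates w = map (conj w) (upTo (length w))

sortedConjugates : Word → List Word
sortedConjugates w = sortWords (conjugates w)

BWT : Word → Word
BWT w = mapMaybe last (sortedConjugates w)

isPrefix : Word → Word → Bool
isPrefix [] _ = true
isPrefix (_ ∷ _) [] = false
isPrefix (x ∷ xs) (y ∷ ys) = (x ==ˢ y) ∧ isPrefix xs ys

filterᵇ : (Word → Bool) → List Word → List Word
filterᵇ p [] = []
filterᵇ p (u ∷ us) = if p u then u ∷ filterᵇ p us else filterᵇ p us

β : Word → Word → Word
β x w = mapMaybe last (filterᵇ (λ u → isPrefix x u) (sortedConjugates w))

runsFrom : Sym → Word → ℕ
runsFrom _ [] = 0
runsFrom c (y ∷ ys) = if c ==ˢ y then runsFrom y ys else suc (runsFrom y ys)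

runs : Word → ℕ
runs [] = 0
runs (x ∷ xs) = suc (runsFrom x xs)

_^ˢ_ : Sym → ℕ → Word
c ^ˢ n = replicate n c

-- ∏_{i=m}^{n} f i  (concatenation in increasing index order; empty if n < m)
∏[_⋯_] : ℕ → ℕ → (ℕ → Word) → Word
∏[ m ⋯ n ] f = concatMap (λ j → f (m + j)) (upTo (suc n ∸ m))

w : ℕ → Word
w k = ∏[ 2 ⋯ k ∸ 1 ] (λ i → (a ∷ (b ^ˢ i)) ++ (a ∷ a ∷ []) ++ (a ∷ (b ^ˢ i)) ++ (a ∷ b ∷ []) ++ (a ^ˢ (i ∸ 2)))
      ++ (a ∷ (b ^ˢ k)) ++ (a ∷ [])

w$ : ℕ → Word
w$ k = w k ++ ($ ∷ [])

βk : ℕ → Word → Word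
βk k x = β x (w$ k)

-- Record every conjugate of w_k$ as a split (suffix, reversed prefix). Walking through w_k block
-- by block lists all splits; regrouping them by their starting position inside the blocks (an
-- exchange of the order of two finite sums over a triangle) yields a permutation consisting of the
-- groups of conjugates that begin with $, a$, aᵐb for m = k−2, …, 1 and bʲa for j = 1, …, k. This
-- list is sorted: the keys increase, and inside a group conjugates are ordered by the length of the
-- next run of a's or b's, which is determined by the block they start in. Insertion sort therefore
-- returns it, β of each key is the sequence of last letters of its group, i.e. the first letters of
-- the reversed prefixes, and counting runs in their concatenation gives 8k − 16.
module Submission where

open import Defs
open import Data.Bool using (true; false)
open import Data.Nat using (ℕ; zero; suc; _+_; _∸_; _*_; _≤_; _<_; z≤n; s≤s)
open import Data.Nat.Properties
  using (≤-refl; ≤-reflexive; ≤-trans; ≤-pred; <⇒≤; n≤1+n; suc-injective; m<m+n; m≤n⇒m≤1+n; m≤m+n; +-suc; +-comm; +-assoc; +-identityʳ;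
         n∸n≡0; m+n∸m≡n; m+n∸n≡m; m+[n∸m]≡n; m∸n+n≡m; m∸[m∸n]≡n; +-∸-assoc)
open import Data.List
  using (List; []; _∷_; _++_; map; concat; concatMap; reverse; replicate; applyUpTo; upTo;
         drop; take; length; mapMaybe; last; head)
open import Data.List.Properties
  using (concatMap-cong; ++-assoc; ++-identityʳ; map-++; map-∘; concat-++; concatMap-++; mapMaybe-++; unfold-reverse; map-applyUpTo)
open import Data.List.Relation.Unary.All as All using (All; []; _∷_)
import Data.List.Relation.Unary.All.Properties as All
open import Data.List.Relation.Unary.Linked as Linked using (Linked; []; [-]; _∷_)
open import Data.List.Relation.Binary.Pointwise using (Pointwise; []; _∷_)
open import Data.List.Relation.Binary.Permutation.Propositional
  using (_↭_; prep; swap; ↭-refl; ↭-reflexive; ↭-sym; ↭-trans)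
import Data.List.Relation.Binary.Permutation.Propositional as ↭
open import Data.List.Relation.Binary.Permutation.Propositional.Properties
  using (++⁺ˡ; ++⁺ʳ; ++⁺; ++-comm; shifts; map⁺)
open import Data.Maybe using (just)
open import Data.Product using (Σ; _×_; _,_; proj₁; proj₂)
open import Relation.Binary.PropositionalEquality
open import Data.Nat.Tactic.RingSolver using (solve-∀)

-- Insertion sort

≤ˡ-total : ∀ u v → (u ≤ˡ v) ≡ false → (v ≤ˡ u) ≡ true
≤ˡ-total [] v ()
≤ˡ-total (x ∷ u) [] e = refl
≤ˡ-total ($ ∷ u) ($ ∷ v) e = ≤ˡ-total u v e
≤ˡ-total ($ ∷ u) (a ∷ v) ()
≤ˡ-total ($ ∷ u) (b ∷ v) ()
≤ˡ-total (a ∷ u) ($ ∷ v) e = refl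
≤ˡ-total (a ∷ u) (a ∷ v) e = ≤ˡ-total u v e
≤ˡ-total (a ∷ u) (b ∷ v) ()
≤ˡ-total (b ∷ u) ($ ∷ v) e = refl
≤ˡ-total (b ∷ u) (a ∷ v) e = refl
≤ˡ-total (b ∷ u) (b ∷ v) e = ≤ˡ-total u v e

≤ˡ-antisym : ∀ u v → (u ≤ˡ v) ≡ true → (v ≤ˡ u) ≡ true → u ≡ v
≤ˡ-antisym [] [] p q = refl
≤ˡ-antisym [] (x ∷ v) p ()
≤ˡ-antisym (x ∷ u) [] () q
≤ˡ-antisym ($ ∷ u) ($ ∷ v) p q = cong ($ ∷_) (≤ˡ-antisym u v p q)
≤ˡ-antisym ($ ∷ u) (a ∷ v) p ()
≤ˡ-antisym ($ ∷ u) (b ∷ v) p ()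
≤ˡ-antisym (a ∷ u) ($ ∷ v) () q
≤ˡ-antisym (a ∷ u) (a ∷ v) p q = cong (a ∷_) (≤ˡ-antisym u v p q)
≤ˡ-antisym (a ∷ u) (b ∷ v) p ()
≤ˡ-antisym (b ∷ u) ($ ∷ v) () q
≤ˡ-antisym (b ∷ u) (a ∷ v) () q
≤ˡ-antisym (b ∷ u) (b ∷ v) p q = cong (b ∷_) (≤ˡ-antisym u v p q)

≤ˡ-trans : ∀ u v x → (u ≤ˡ v) ≡ true → (v ≤ˡ x) ≡ true → (u ≤ˡ x) ≡ true
≤ˡ-trans [] v x p q = refl
≤ˡ-trans (y ∷ u) [] x () q
≤ˡ-trans (y ∷ u) (z ∷ v) [] p ()
≤ˡ-trans ($ ∷ u) ($ ∷ v) ($ ∷ x) p q = ≤ˡ-trans u v x p q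
≤ˡ-trans ($ ∷ u) ($ ∷ v) (a ∷ x) p q = refl
≤ˡ-trans ($ ∷ u) ($ ∷ v) (b ∷ x) p q = refl
≤ˡ-trans ($ ∷ u) (a ∷ v) ($ ∷ x) p ()
≤ˡ-trans ($ ∷ u) (a ∷ v) (a ∷ x) p q = refl
≤ˡ-trans ($ ∷ u) (a ∷ v) (b ∷ x) p q = refl
≤ˡ-trans ($ ∷ u) (b ∷ v) ($ ∷ x) p ()
≤ˡ-trans ($ ∷ u) (b ∷ v) (a ∷ x) p ()
≤ˡ-trans ($ ∷ u) (b ∷ v) (b ∷ x) p q = refl
≤ˡ-trans (a ∷ u) ($ ∷ v) z () q
≤ˡ-trans (a ∷ u) (a ∷ v) ($ ∷ x) p ()
≤ˡ-trans (a ∷ u) (a ∷ v) (a ∷ x) p q = ≤ˡ-trans u v x p q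
≤ˡ-trans (a ∷ u) (a ∷ v) (b ∷ x) p q = refl
≤ˡ-trans (a ∷ u) (b ∷ v) ($ ∷ x) p ()
≤ˡ-trans (a ∷ u) (b ∷ v) (a ∷ x) p ()
≤ˡ-trans (a ∷ u) (b ∷ v) (b ∷ x) p q = refl
≤ˡ-trans (b ∷ u) ($ ∷ v) z () q
≤ˡ-trans (b ∷ u) (a ∷ v) z () q
≤ˡ-trans (b ∷ u) (b ∷ v) ($ ∷ x) p ()
≤ˡ-trans (b ∷ u) (b ∷ v) (a ∷ x) p ()
≤ˡ-trans (b ∷ u) (b ∷ v) (b ∷ x) p q = ≤ˡ-trans u v x p q

Sorted : List Word → Set
Sorted = Linked (λ u v → (u ≤ˡ v) ≡ true)

sortWords-sorted : ∀ {xs} → Sorted xs → sortWords xs ≡ xs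
sortWords-sorted [] = refl
sortWords-sorted [-] = refl
sortWords-sorted (_∷_ {y = v} {xs = vs} p s) rewrite sortWords-sorted s | p = refl

insert-comm : ∀ x y zs → insert x (insert y zs) ≡ insert y (insert x zs)
insert-comm x y [] with x ≤ˡ y in xy | y ≤ˡ x in yx
... | true | true rewrite ≤ˡ-antisym x y xy yx = refl
... | true | false = refl
... | false | true = refl
... | false | false with () ← trans (sym (≤ˡ-total x y xy)) yx
insert-comm x y (z ∷ zs) with y ≤ˡ z in yz | x ≤ˡ z in xz
insert-comm x y (z ∷ zs) | true | true with x ≤ˡ y in xy | y ≤ˡ x in yx
... | true | true rewrite ≤ˡ-antisym x y xy yx = refl
... | true | false rewrite yz = refl
... | false | true rewrite xz = refl
... | false | false with () ← trans (sym (≤ˡ-total x y xy)) yx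
insert-comm x y (z ∷ zs) | true | false with x ≤ˡ y in xy
... | true with () ← trans (sym (≤ˡ-trans x y z xy yz)) xz
... | false rewrite xz | yz = refl
insert-comm x y (z ∷ zs) | false | true with y ≤ˡ x in yx
... | true with () ← trans (sym (≤ˡ-trans y x z yx xz)) yz
... | false rewrite xz | yz = refl
insert-comm x y (z ∷ zs) | false | false rewrite xz | yz = cong (z ∷_) (insert-comm x y zs)

sortWords-↭ : ∀ {xs ys} → xs ↭ ys → sortWords xs ≡ sortWords ys
sortWords-↭ ↭.refl = refl
sortWords-↭ (prep x p) = cong (insert x) (sortWords-↭ p)
sortWords-↭ (swap {ys = ys} x y p) rewrite sortWords-↭ p = insert-comm x y (sortWords ys)
sortWords-↭ (↭.trans p q) = trans (sortWords-↭ p) (sortWords-↭ q)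

sortWords-unique : ∀ {xs ys} → xs ↭ ys → Sorted ys → sortWords xs ≡ ys
sortWords-unique p s = trans (sortWords-↭ p) (sortWords-sorted s)

-- Index ranges and permutations

range : ℕ → ℕ → List ℕ
range s zero = []
range s (suc n) = s ∷ range (suc s) n

rangeDesc : ℕ → ℕ → List ℕ
rangeDesc s zero = []
rangeDesc s (suc n) = (s + n) ∷ rangeDesc s n

applyUpTo-cong : ∀ {A : Set} (f g : ℕ → A) n → (∀ i → f i ≡ g i) → applyUpTo f n ≡ applyUpTo g n
applyUpTo-cong f g zero e = refl
applyUpTo-cong f g (suc n) e =
  cong₂ _∷_ (e 0) (applyUpTo-cong (λ i → f (suc i)) (λ i → g (suc i)) n (λ i → e (suc i)))

range-++ : ∀ s m n → range s (m + n) ≡ range s m ++ range (s + m) n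
range-++ s zero n = cong (λ t → range t n) (sym (+-identityʳ s))
range-++ s (suc m) n =
  cong (s ∷_) (trans (range-++ (suc s) m n) (cong (λ t → range (suc s) m ++ range t n) (sym (+-suc s m))))

range-snoc : ∀ s n → range s (suc n) ≡ range s n ++ (s + n) ∷ []
range-snoc s n = trans (cong (range s) (sym (+-comm n 1))) (range-++ s n 1)

rangeDesc-++ : ∀ s m n → rangeDesc s (m + n) ≡ rangeDesc (s + n) m ++ rangeDesc s n
rangeDesc-++ s zero n = refl
rangeDesc-++ s (suc m) n =
  cong₂ _∷_ (trans (cong (s +_) (+-comm m n)) (sym (+-assoc s n m))) (rangeDesc-++ s m n)

module _ {A : Set} where

  concatMap-[-] : ∀ {B : Set} (f : B → A) xs → concatMap (λ x → f x ∷ []) xs ≡ map f xs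
  concatMap-[-] f [] = refl
  concatMap-[-] f (x ∷ xs) = cong (f x ∷_) (concatMap-[-] f xs)

  concatMap-↭ : ∀ {B : Set} (f g : B → List A) xs → (∀ x → f x ↭ g x) → concatMap f xs ↭ concatMap g xs
  concatMap-↭ f g [] p = ↭-refl
  concatMap-↭ f g (x ∷ xs) p = ++⁺ (p x) (concatMap-↭ f g xs p)

  concatMap-++-↭ : ∀ {B : Set} (f g : B → List A) xs →
                   concatMap (λ x → f x ++ g x) xs ↭ concatMap f xs ++ concatMap g xs
  concatMap-++-↭ f g [] = ↭-refl
  concatMap-++-↭ f g (x ∷ xs) = ↭-trans (↭-reflexive (++-assoc (f x) (g x) _))
    (↭-trans (++⁺ˡ (f x) (↭-trans (++⁺ˡ (g x) (concatMap-++-↭ f g xs)) (shifts (g x) (concatMap f xs))))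
      (↭-reflexive (sym (++-assoc (f x) _ _))))

  concatMap-∷-↭ : ∀ {B : Set} (x : B → A) (g : B → List A) xs →
                  concatMap (λ i → x i ∷ g i) xs ↭ map x xs ++ concatMap g xs
  concatMap-∷-↭ x g xs =
    ↭-trans (concatMap-++-↭ (λ i → x i ∷ []) g xs) (++⁺ʳ _ (↭-reflexive (concatMap-[-] x xs)))

  concat-↭ : ∀ {xss yss : List (List A)} → xss ↭ yss → concat xss ↭ concat yss
  concat-↭ ↭.refl = ↭-refl
  concat-↭ (prep x p) = ++⁺ˡ x (concat-↭ p)
  concat-↭ (swap x y p) = ↭-trans (↭-reflexive (sym (++-assoc x y _)))
    (↭-trans (++⁺ (++-comm x y) (concat-↭ p)) (↭-reflexive (++-assoc y x _)))
  concat-↭ (↭.trans p q) = ↭-trans (concat-↭ p) (concat-↭ q)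

  concatMap-cong-range : ∀ {f g : ℕ → List A} s n → (∀ x → s ≤ x → x < s + n → f x ≡ g x) →
                         concatMap f (range s n) ≡ concatMap g (range s n)
  concatMap-cong-range s zero e = refl
  concatMap-cong-range s (suc n) e =
    cong₂ _++_ (e s ≤-refl (subst (s <_) (sym (+-suc s n)) (s≤s (m≤m+n s n))))
      (concatMap-cong-range (suc s) n (λ x p q → e x (≤-trans (n≤1+n s) p) (subst (x <_) (sym (+-suc s n)) q)))

  concatMap-cong-rangeDesc : ∀ {f g : ℕ → List A} s n → (∀ x → s ≤ x → x < s + n → f x ≡ g x) →
                             concatMap f (rangeDesc s n) ≡ concatMap g (rangeDesc s n)
  concatMap-cong-rangeDesc s zero e = refl
  concatMap-cong-rangeDesc s (suc n) e =
    cong₂ _++_ (e (s + n) (m≤m+n s n) (subst (s + n <_) (sym (+-suc s n)) ≤-refl))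
      (concatMap-cong-rangeDesc s n (λ i p q → e i p (≤-trans q (subst (s + n ≤_) (sym (+-suc s n)) (n≤1+n _)))))

  concatMap-range-suc : ∀ (f : ℕ → List A) s n → concatMap f (range (suc s) n) ≡ concatMap (λ x → f (suc x)) (range s n)
  concatMap-range-suc f s zero = refl
  concatMap-range-suc f s (suc n) = cong (f (suc s) ++_) (concatMap-range-suc f (suc s) n)

  map-range-suc : ∀ (f : ℕ → A) s n → map f (range (suc s) n) ≡ map (λ x → f (suc x)) (range s n)
  map-range-suc f s zero = refl
  map-range-suc f s (suc n) = cong (f (suc s) ∷_) (map-range-suc f (suc s) n)

  concatMap-rangeDesc-+ : ∀ (f : ℕ → List A) d s N →
                          concatMap f (rangeDesc (d + s) N) ≡ concatMap (λ t → f (d + t)) (rangeDesc s N)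
  concatMap-rangeDesc-+ f d s zero = refl
  concatMap-rangeDesc-+ f d s (suc N) = cong₂ _++_ (cong f (+-assoc d s N)) (concatMap-rangeDesc-+ f d s N)

  concatMap-rangeDesc-↭ : ∀ (f : ℕ → List A) s n → concatMap f (rangeDesc s n) ↭ concatMap f (range s n)
  concatMap-rangeDesc-↭ f s zero = ↭-refl
  concatMap-rangeDesc-↭ f s (suc n) = ↭-trans (++⁺ˡ (f (s + n)) (concatMap-rangeDesc-↭ f s n))
    (↭-trans (++-comm (f (s + n)) (concatMap f (range s n)))
      (↭-reflexive (trans (cong (concatMap f (range s n) ++_) (sym (++-identityʳ (f (s + n)))))
        (trans (sym (concatMap-++ f (range s n) ((s + n) ∷ []))) (cong (concatMap f) (sym (range-snoc s n)))))))

  map-rangeDesc-↭ : ∀ (f : ℕ → A) s n → map f (rangeDesc s n) ↭ map f (range s n)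
  map-rangeDesc-↭ f s n = ↭-trans (↭-reflexive (sym (concatMap-[-] f (rangeDesc s n))))
    (↭-trans (concatMap-rangeDesc-↭ (λ x → f x ∷ []) s n) (↭-reflexive (concatMap-[-] f (range s n))))

  concatMap-range-∸ : ∀ (h : ℕ → List A) c N s t → t + N + s ≡ suc c →
                      concatMap (λ i → h (c ∸ i)) (range s N) ≡ concatMap h (rangeDesc t N)
  concatMap-range-∸ h c zero s t e = refl
  concatMap-range-∸ h c (suc N) s t e =
    cong₂ _++_ (cong h (trans (cong (_∸ s) (sym e′)) (m+n∸n≡m (t + N) s)))
      (concatMap-range-∸ h c N (suc s) t (trans (+-suc (t + N) s) (cong suc e′)))
    where
    e′ : t + N + s ≡ c
    e′ = suc-injective (trans (sym (cong (_+ s) (+-suc t N))) e)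

  map-rangeDesc₁-snoc : ∀ (g : ℕ → A) t → map g (rangeDesc 1 (suc t)) ≡ map (λ j → g (suc j)) (rangeDesc 1 t) ++ g 1 ∷ []
  map-rangeDesc₁-snoc g zero = refl
  map-rangeDesc₁-snoc g (suc t) = cong (g (suc (suc t)) ∷_) (map-rangeDesc₁-snoc g t)

  -- Summing g t j over the triangle 1 ≤ j ≤ t < N by rows or by columns.
  triangle-↭ : ∀ (g : ℕ → ℕ → A) N →
    concatMap (λ t → map (g t) (rangeDesc 1 t)) (range 0 N) ↭ concatMap (λ j → map (λ t → g t j) (range j (N ∸ j))) (range 1 N)
  triangle-↭ g zero = ↭-refl
  triangle-↭ g (suc N) =
    ↭-trans (↭-reflexive (trans (cong (concatMap row) (range-snoc 0 N)) (concatMap-++ row (range 0 N) (N ∷ []))))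
     (↭-trans (++⁺ (triangle-↭ g N) (↭-trans (↭-reflexive (++-identityʳ (map (g N) (rangeDesc 1 N)))) (map-rangeDesc-↭ (g N) 1 N)))
     (↭-sym (↭-trans (↭-reflexive (trans (cong (concatMap col) (range-snoc 1 N)) (concatMap-++ col (range 1 N) ((1 + N) ∷ []))))
        (↭-trans (↭-reflexive (trans (cong (λ z → concatMap col (range 1 N) ++ map (λ t → g t (suc N)) (range (suc N) z) ++ [])
                                            (n∸n≡0 N))
                                      (++-identityʳ _)))
          (↭-trans (↭-reflexive (concatMap-cong-range 1 N (λ x p q → colSplit x q)))
            (↭-trans (concatMap-++-↭ (λ j → map (λ t → g t j) (range j (N ∸ j))) (λ j → g N j ∷ []) (range 1 N))
              (++⁺ˡ _ (↭-reflexive (concatMap-[-] (g N) (range 1 N))))))))))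
    where
    row = λ t → map (g t) (rangeDesc 1 t)
    col = λ j → map (λ t → g t j) (range j (suc N ∸ j))
    colSplit : ∀ x → x < 1 + N → col x ≡ map (λ t → g t x) (range x (N ∸ x)) ++ g N x ∷ []
    colSplit x q = trans (cong (map (λ t → g t x)) (trans (cong (range x) (+-∸-assoc 1 (≤-pred q))) (range-snoc x (N ∸ x))))
      (trans (map-++ (λ t → g t x) (range x (N ∸ x)) _)
        (cong (λ z → map (λ t → g t x) (range x (N ∸ x)) ++ g z x ∷ []) (m+[n∸m]≡n (≤-pred q))))

-- permuteBy ps xs: ps is a Lehmer code, i.e. repeatedly bring the p-th of the remaining elements to the front.
module _ {X : Set} where

  private
    swapFront : X → List X → List X
    swapFront x [] = x ∷ []
    swapFront x (y ∷ ys) = y ∷ x ∷ ys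

    pick : ℕ → List X → List X
    pick zero xs = xs
    pick (suc p) [] = []
    pick (suc p) (x ∷ xs) = swapFront x (pick p xs)

    swapFront-↭ : ∀ x l → swapFront x l ↭ x ∷ l
    swapFront-↭ x [] = ↭-refl
    swapFront-↭ x (y ∷ ys) = swap y x ↭-refl

    pick-↭ : ∀ p xs → pick p xs ↭ xs
    pick-↭ zero xs = ↭-refl
    pick-↭ (suc p) [] = ↭-refl
    pick-↭ (suc p) (x ∷ xs) = ↭-trans (swapFront-↭ x (pick p xs)) (prep x (pick-↭ p xs))

    consWith : (List X → List X) → List X → List X
    consWith r [] = []
    consWith r (y ∷ ys) = y ∷ r ys

  permuteBy : List ℕ → List X → List X
  permuteBy [] xs = xs
  permuteBy (p ∷ ps) xs = consWith (permuteBy ps) (pick p xs)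

  permuteBy-↭ : ∀ ps xs → permuteBy ps xs ↭ xs
  permuteBy-↭ [] xs = ↭-refl
  permuteBy-↭ (p ∷ ps) xs = ↭-trans (consWith-↭ (pick p xs)) (pick-↭ p xs)
    where
    consWith-↭ : ∀ l → consWith (permuteBy ps) l ↭ l
    consWith-↭ [] = ↭-refl
    consWith-↭ (y ∷ ys) = prep y (permuteBy-↭ ps ys)

concat-permuteBy-↭ : ∀ {X : Set} (ps : List ℕ) (L : List (List X)) → concat (permuteBy ps L) ↭ concat L
concat-permuteBy-↭ ps L = concat-↭ (permuteBy-↭ ps L)

concat-expand-↭ : ∀ {X : Set} (pre : List (List X)) {A : List X} (Bs : List (List X)) rest → A ↭ concat Bs →
                  concat (pre ++ A ∷ rest) ↭ concat (pre ++ Bs ++ rest)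
concat-expand-↭ pre {A} Bs rest p = ↭-trans (↭-reflexive (sym (concat-++ pre (A ∷ rest))))
  (↭-trans (++⁺ˡ (concat pre) (↭-trans (++⁺ʳ (concat rest) p) (↭-reflexive (concat-++ Bs rest))))
     (↭-reflexive (concat-++ pre (Bs ++ rest))))

-- Conjugates of w_k as splits

-- (u , r) stands for the conjugate u ++ reverse r: the suffix starting at the split point,
-- followed by the prefix before it, which is kept reversed so that splitting moves one letter.
Split : Set
Split = Word × Word

rotation : Split → Word
rotation (u , r) = u ++ reverse r

splits : Word → Word → List Split
splits r [] = []
splits r (x ∷ u) = (x ∷ u , r) ∷ splits (x ∷ r) u

conjugates-splits : ∀ W → conjugates W ≡ map rotation (splits [] W)
conjugates-splits W = trans (map-applyUpTo (λ i → i) (conj W) (length W)) (go W [])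
  where
  go : ∀ u r → applyUpTo (λ i → drop i u ++ reverse r ++ take i u) (length u) ≡ map rotation (splits r u)
  go [] r = refl
  go (x ∷ u) r = cong₂ _∷_ (cong ((x ∷ u) ++_) (++-identityʳ (reverse r)))
    (trans (applyUpTo-cong _ _ (length u) (λ i → cong (drop i u ++_)
              (trans (sym (++-assoc (reverse r) (x ∷ []) (take i u)))
                     (cong (_++ take i u) (sym (unfold-reverse x r))))))
           (go u (x ∷ r)))

replicate-snoc : ∀ (c : Sym) n r → replicate n c ++ c ∷ r ≡ c ∷ replicate n c ++ r
replicate-snoc c zero r = refl
replicate-snoc c (suc n) r = cong (c ∷_) (replicate-snoc c n r)

map-cong-rangeDesc₁ : ∀ {A : Set} (f g : ℕ → A) n → (∀ j → j ≤ n → f j ≡ g j) →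
                      map f (rangeDesc 1 n) ≡ map g (rangeDesc 1 n)
map-cong-rangeDesc₁ f g zero e = refl
map-cong-rangeDesc₁ f g (suc n) e =
  cong₂ _∷_ (e (suc n) ≤-refl) (map-cong-rangeDesc₁ f g n (λ j p → e j (m≤n⇒m≤1+n p)))

splits-replicate : ∀ (c : Sym) n r Y → splits r (replicate n c ++ Y) ≡
  map (λ j → (replicate j c ++ Y , replicate (n ∸ j) c ++ r)) (rangeDesc 1 n) ++ splits (replicate n c ++ r) Y
splits-replicate c zero r Y = refl
splits-replicate c (suc n) r Y =
  cong₂ _∷_ (cong (λ t → (c ∷ replicate n c ++ Y , replicate t c ++ r)) (sym (n∸n≡0 n)))
    (trans (splits-replicate c n (c ∷ r) Y)
      (cong₂ _++_
        (map-cong-rangeDesc₁ _ _ n (λ j p → cong (λ z → (replicate j c ++ Y , z))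
          (trans (replicate-snoc c (n ∸ j) r) (cong (λ t → replicate t c ++ r) (sym (+-∸-assoc 1 p))))))
        (cong (λ z → splits z Y) (replicate-snoc c n r))))

-- block i = a bⁱ a a a bⁱ a b aⁱ⁻²; Q₁ i V and Q₂ i V are what follows its first and second run of b's.
block : ℕ → Word
block i = (a ∷ (b ^ˢ i)) ++ (a ∷ a ∷ []) ++ (a ∷ (b ^ˢ i)) ++ (a ∷ b ∷ []) ++ (a ^ˢ (i ∸ 2))

Q₂ : ℕ → Word → Word
Q₂ i V = a ∷ b ∷ (a ^ˢ (i ∸ 2)) ++ V

Q₁ : ℕ → Word → Word
Q₁ i V = a ∷ a ∷ a ∷ (b ^ˢ i) ++ Q₂ i V

block-++ : ∀ i V → block i ++ V ≡ a ∷ (b ^ˢ i) ++ Q₁ i V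
block-++ i V = cong (a ∷_) (trans (++-assoc (b ^ˢ i) _ V)
  (cong (λ z → (b ^ˢ i) ++ a ∷ a ∷ a ∷ z) (++-assoc (b ^ˢ i) _ V)))

tailWord : ℕ → Word
tailWord k = a ∷ (b ^ˢ k) ++ a ∷ $ ∷ []

blocks : ℕ → ℕ → Word
blocks s zero = []
blocks s (suc n) = block s ++ blocks (suc s) n

-- The part of block i before Q₁, before Q₂, and the whole block, reversed and put in front of r.
revQ₁ : ℕ → Word → Word
revQ₁ i r = a ∷ a ∷ a ∷ (b ^ˢ i) ++ a ∷ r

revQ₂ : ℕ → Word → Word
revQ₂ i r = b ∷ a ∷ (b ^ˢ i) ++ revQ₁ i r

revBlockOn : ℕ → Word → Word
revBlockOn i r = (a ^ˢ (i ∸ 2)) ++ revQ₂ i r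

-- The splits of a block with reversed prefix r and suffix V, by starting position: e₀ at the block
-- start, eF j inside the first b-run, e₁ e₂ e₃ at the three following a's, eS j inside the second
-- b-run, e₄ e₅ at the following a and b, eR m inside the final a-run.
e₀ e₁ e₂ e₃ e₄ e₅ : ℕ → Word → Word → Split
e₀ i r V = (a ∷ (b ^ˢ i) ++ Q₁ i V , r)
e₁ i r V = (Q₁ i V , (b ^ˢ i) ++ a ∷ r)
e₂ i r V = (a ∷ a ∷ (b ^ˢ i) ++ Q₂ i V , a ∷ (b ^ˢ i) ++ a ∷ r)
e₃ i r V = (a ∷ (b ^ˢ i) ++ Q₂ i V , a ∷ a ∷ (b ^ˢ i) ++ a ∷ r)
e₄ i r V = (Q₂ i V , (b ^ˢ i) ++ revQ₁ i r)
e₅ i r V = (b ∷ (a ^ˢ (i ∸ 2)) ++ V , a ∷ (b ^ˢ i) ++ revQ₁ i r)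

eF eS eR : ℕ → Word → Word → ℕ → Split
eF i r V j = ((b ^ˢ j) ++ Q₁ i V , (b ^ˢ (i ∸ j)) ++ a ∷ r)
eS i r V j = ((b ^ˢ j) ++ Q₂ i V , (b ^ˢ (i ∸ j)) ++ revQ₁ i r)
eR i r V m = ((a ^ˢ m) ++ V , (a ^ˢ (i ∸ 2 ∸ m)) ++ revQ₂ i r)

blockSplits : ℕ → Word → Word → List Split
blockSplits i r V =
  e₀ i r V ∷ (map (eF i r V) (rangeDesc 1 i) ++ (e₁ i r V ∷ e₂ i r V ∷ e₃ i r V ∷
  (map (eS i r V) (rangeDesc 1 i) ++ (e₄ i r V ∷ e₅ i r V ∷ map (eR i r V) (rangeDesc 1 (i ∸ 2))))))

splits-block : ∀ i r V → splits r (a ∷ (b ^ˢ i) ++ Q₁ i V) ≡ blockSplits i r V ++ splits (revBlockOn i r) V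
splits-block i r V =
  trans (cong (e₀ i r V ∷_) (trans (splits-replicate b i (a ∷ r) (Q₁ i V))
    (cong (map (eF i r V) (rangeDesc 1 i) ++_) (cong (λ z → e₁ i r V ∷ e₂ i r V ∷ e₃ i r V ∷ z)
      (trans (splits-replicate b i (revQ₁ i r) (Q₂ i V))
        (cong (map (eS i r V) (rangeDesc 1 i) ++_) (cong (λ z → e₄ i r V ∷ e₅ i r V ∷ z)
           (splits-replicate a (i ∸ 2) (revQ₂ i r) V))))))))
  (sym (cong (e₀ i r V ∷_) (trans (++-assoc (map (eF i r V) (rangeDesc 1 i)) _ _)
    (cong (map (eF i r V) (rangeDesc 1 i) ++_) (cong (λ z → e₁ i r V ∷ e₂ i r V ∷ e₃ i r V ∷ z)
      (++-assoc (map (eS i r V) (rangeDesc 1 i)) _ _))))))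

tailSplits : ℕ → Word → List Split
tailSplits k r = (tailWord k , r) ∷ (map (λ j → ((b ^ˢ j) ++ a ∷ $ ∷ [] , (b ^ˢ (k ∸ j)) ++ a ∷ r)) (rangeDesc 1 k)
  ++ ((a ∷ $ ∷ [] , (b ^ˢ k) ++ a ∷ r) ∷ ($ ∷ [] , a ∷ (b ^ˢ k) ++ a ∷ r) ∷ []))

splits-tailWord : ∀ k r → splits r (tailWord k) ≡ tailSplits k r
splits-tailWord k r = cong ((tailWord k , r) ∷_) (splits-replicate b k (a ∷ r) (a ∷ $ ∷ []))

revPrefix : ℕ → Word
revPrefix zero = []
revPrefix (suc zero) = []
revPrefix (suc (suc zero)) = []
revPrefix (suc (suc (suc i))) = revBlockOn (suc (suc i)) (revPrefix (suc (suc i)))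

suffixAfter : ℕ → ℕ → Word
suffixAfter k i = blocks (suc i) (k ∸ suc i) ++ tailWord k

allSplits : ℕ → List Split
allSplits k = concatMap (λ i → blockSplits i (revPrefix i) (suffixAfter k i)) (range 2 (k ∸ 2))
              ++ tailSplits k (revPrefix k)

splits-blocks : ∀ k n s → suc (suc s) + n ≡ k →
  splits (revPrefix (suc (suc s))) (blocks (suc (suc s)) n ++ tailWord k) ≡
    concatMap (λ i → blockSplits i (revPrefix i) (suffixAfter k i)) (range (suc (suc s)) n) ++ tailSplits k (revPrefix k)
splits-blocks k zero s e rewrite +-identityʳ s | sym e = splits-tailWord (suc (suc s)) _
splits-blocks k (suc n) s e =
  begin
    splits (revPrefix i) ((block i ++ blocks (suc i) n) ++ tailWord k)
  ≡⟨ cong (splits (revPrefix i)) (trans (++-assoc (block i) _ (tailWord k)) (block-++ i V)) ⟩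
    splits (revPrefix i) (a ∷ (b ^ˢ i) ++ Q₁ i V)
  ≡⟨ splits-block i (revPrefix i) V ⟩
    blockSplits i (revPrefix i) V ++ splits (revPrefix (suc i)) V
  ≡⟨ cong₂ _++_ (cong (blockSplits i (revPrefix i)) V≡) (splits-blocks k n (suc s) (trans (sym (+-suc i n)) e)) ⟩
    blockSplits i (revPrefix i) (suffixAfter k i) ++ (concatMap B (range (suc i) n) ++ tailSplits k (revPrefix k))
  ≡⟨ sym (++-assoc (blockSplits i (revPrefix i) (suffixAfter k i)) _ _) ⟩
    concatMap B (range i (suc n)) ++ tailSplits k (revPrefix k)
  ∎
  where
  open ≡-Reasoning
  i = suc (suc s)
  V = blocks (suc i) n ++ tailWord k
  B = λ i → blockSplits i (revPrefix i) (suffixAfter k i)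
  V≡ : V ≡ suffixAfter k i
  V≡ = cong (λ t → blocks (suc i) t ++ tailWord k)
         (sym (trans (cong (_∸ suc i) (sym e)) (trans (cong (_∸ suc i) (+-suc i n)) (m+n∸m≡n i n))))

∏-block : ∀ s n → concat (map (λ j → block (s + j)) (applyUpTo (λ x → x) n)) ≡ blocks s n
∏-block s zero = refl
∏-block s (suc n) = cong₂ _++_ (cong block (+-identityʳ s))
  (trans (cong concat (trans (map-applyUpTo suc (λ j → block (s + j)) n)
     (trans (applyUpTo-cong _ _ n (λ j → cong block (+-suc s j)))
            (sym (map-applyUpTo (λ x → x) (λ j → block (suc s + j)) n)))))
   (∏-block (suc s) n))

w$-blocks : ∀ k → w$ (suc k) ≡ blocks 2 (suc k ∸ 2) ++ tailWord (suc k)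
w$-blocks k = trans (++-assoc (∏[ 2 ⋯ k ] block) _ ($ ∷ []))
  (cong₂ _++_ (∏-block 2 (suc k ∸ 2)) (cong (a ∷_) (++-assoc (b ^ˢ suc k) (a ∷ []) ($ ∷ []))))

conjugates-w$ : ∀ k → conjugates (w$ (suc (suc k))) ≡ map rotation (allSplits (suc (suc k)))
conjugates-w$ k = trans (conjugates-splits _) (cong (map rotation)
  (trans (cong (splits []) (w$-blocks (suc k))) (splits-blocks (suc (suc k)) k zero refl)))

-- Regrouping the splits

-- The splits of w_(6+n)$ named by block i and position; groupA m (resp. groupB j) lists the splits
-- whose rotation begins with aᵐb (resp. bʲa), in the order that turns out to be lexicographic.
module Layout (n : ℕ) where

  k : ℕ
  k = 6 + n

  V : ℕ → Word
  V i = suffixAfter k i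

  E₀ E₁ E₂ E₃ E₄ E₅ : ℕ → Split
  E₀ i = e₀ i (revPrefix i) (V i)
  E₁ i = e₁ i (revPrefix i) (V i)
  E₂ i = e₂ i (revPrefix i) (V i)
  E₃ i = e₃ i (revPrefix i) (V i)
  E₄ i = e₄ i (revPrefix i) (V i)
  E₅ i = e₅ i (revPrefix i) (V i)

  F S R : ℕ → ℕ → Split
  F i j = eF i (revPrefix i) (V i) j
  S i j = eS i (revPrefix i) (V i) j
  R i m = eR i (revPrefix i) (V i) m

  Tb : ℕ → Split
  Tb j = ((b ^ˢ j) ++ a ∷ $ ∷ [] , (b ^ˢ (k ∸ j)) ++ a ∷ revPrefix k)

  T₀ Ta T$ : Split
  T₀ = (tailWord k , revPrefix k)
  Ta = (a ∷ $ ∷ [] , (b ^ˢ k) ++ a ∷ revPrefix k)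
  T$ = ($ ∷ [] , a ∷ (b ^ˢ k) ++ a ∷ revPrefix k)

  I : List ℕ
  I = range 2 (4 + n)

  F₁ S₁ : ℕ → Split
  F₁ i = F i 1
  S₁ i = S i 1

  Rcol : ℕ → List Split
  Rcol m = map (λ i → R i m) (range (2 + m) ((4 + n) ∸ m))

  Fcol Scol ScolDesc : ℕ → List Split
  Fcol j = map (λ i → F i j) (range j (k ∸ j))
  Scol j = map (λ i → S i j) (range j (k ∸ j))
  ScolDesc j = map (λ i → S i j) (rangeDesc j (k ∸ j))

  pairsE₀E₃ : List Split
  pairsE₀E₃ = concatMap (λ i → E₀ i ∷ E₃ i ∷ []) (range 4 (2 + n))

  pairsRE₂ : List Split
  pairsRE₂ = concatMap (λ i → R i 1 ∷ E₂ (suc i) ∷ []) (range 4 (1 + n))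

  pairsRE₁ : List Split
  pairsRE₁ = concatMap (λ i → R i 2 ∷ E₁ (suc i) ∷ []) (range 5 n)

  groupA : ℕ → List Split
  groupA 0 = []
  groupA 1 = map E₄ (rangeDesc 2 (4 + n)) ++ E₀ 2 ∷ E₃ 2 ∷ E₀ 3 ∷ E₃ 3 ∷ pairsE₀E₃ ++ T₀ ∷ []
  groupA 2 = E₂ 2 ∷ E₂ 3 ∷ R 3 1 ∷ E₂ 4 ∷ pairsRE₂ ++ R (5 + n) 1 ∷ []
  groupA 3 = E₁ 2 ∷ E₁ 3 ∷ E₁ 4 ∷ R 4 2 ∷ E₁ 5 ∷ pairsRE₁ ++ R (5 + n) 2 ∷ []
  groupA (suc (suc (suc (suc m)))) = Rcol (3 + m)

  groupB₁-tail₂ groupB₁-tail₁ : List Split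
  groupB₁-tail₂ = E₅ 3 ∷ (map S₁ (rangeDesc 2 (4 + n)) ++ E₅ 2 ∷ [])
  groupB₁-tail₁ = F 2 1 ∷ F 3 1 ∷ F 4 1 ∷ E₅ 4 ∷ (map F₁ (range 5 (1 + n)) ++ groupB₁-tail₂)

  groupB : ℕ → List Split
  groupB 0 = []
  groupB 1 = Tb 1 ∷ map E₅ (rangeDesc 5 (1 + n)) ++ groupB₁-tail₁
  groupB (suc (suc j)) = Tb (2 + j) ∷ Fcol (2 + j) ++ ScolDesc (2 + j)

  sortedSplits : List Split
  sortedSplits = T$ ∷ Ta ∷ concatMap groupA (rangeDesc 1 (4 + n)) ++ concatMap groupB (range 1 k)

  Fcols Scols Rcols₃ Tbs : List Split
  Fcols = concatMap Fcol (range 2 (5 + n))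
  Scols = concatMap Scol (range 2 (5 + n))
  Rcols₃ = concatMap Rcol (range 3 (1 + n))
  Tbs = map Tb (range 2 (5 + n))

module Regrouping (n : ℕ) where
  open Layout n

  private
    ++-↭-assoc : ∀ {X : Set} {P Y Z : List X} (W : List X) → P ↭ Y ++ Z → P ++ W ↭ Y ++ (Z ++ W)
    ++-↭-assoc {Y = Y} {Z} W p = ↭-trans (++⁺ʳ W p) (↭-reflexive (++-assoc Y Z W))

    two : ∀ {X Y Z : List Split} → Z ↭ X ++ Y → Z ↭ concat (X ∷ Y ∷ [])
    two {X} {Y} p = ↭-trans p (↭-reflexive (cong (X ++_) (sym (++-identityʳ Y))))

  triangle-cols-↭ : (X : ℕ → ℕ → Split) → concatMap (λ i → map (X i) (rangeDesc 1 i)) (range 2 (4 + n)) ↭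
    concatMap (λ j → map (λ i → X i j) (range j (k ∸ j))) (range 2 (5 + n)) ++ map (λ i → X i 1) (range 2 (4 + n))
  triangle-cols-↭ X =
    ↭-trans (↭-reflexive (trans (concatMap-range-suc (λ i → map (X i) (rangeDesc 1 i)) 1 (4 + n))
                                (concatMap-cong (λ t → map-rangeDesc₁-snoc (X (suc t)) t) (range 1 (4 + n)))))
     (↭-trans (concatMap-++-↭ (λ t → map (λ j → X (suc t) (suc j)) (rangeDesc 1 t)) (λ t → X (suc t) 1 ∷ []) (range 1 (4 + n)))
       (++⁺ (↭-trans (triangle-↭ (λ t j → X (suc t) (suc j)) (5 + n))
               (↭-reflexive (trans (concatMap-cong (λ j → sym (map-range-suc (λ i → X i (suc j)) j ((5 + n) ∸ j)))
                                                   (range 1 (5 + n)))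
                                   (sym (concatMap-range-suc (λ j → map (λ i → X i j) (range j (k ∸ j))) 1 (5 + n))))))
            (↭-reflexive (trans (concatMap-[-] (λ t → X (suc t) 1) (range 1 (4 + n)))
                                (sym (map-range-suc (λ i → X i 1) 1 (4 + n)))))))

  triangle-Rcols-↭ : concatMap (λ i → map (R i) (rangeDesc 1 (i ∸ 2))) (range 2 (4 + n)) ↭ Rcol 1 ++ Rcol 2 ++ Rcols₃
  triangle-Rcols-↭ =
    ↭-trans (↭-reflexive (trans (concatMap-range-suc (λ i → map (R i) (rangeDesc 1 (i ∸ 2))) 1 (4 + n))
                                (concatMap-range-suc (λ i → map (R (suc i)) (rangeDesc 1 (suc i ∸ 2))) 0 (4 + n))))
     (↭-trans (triangle-↭ (λ t m → R (2 + t) m) (4 + n))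
       (↭-reflexive (trans (concatMap-cong (λ m → sym (trans (map-range-suc (λ i → R i m) (1 + m) ((4 + n) ∸ m))
                                                (map-range-suc (λ i → R (suc i) m) m ((4 + n) ∸ m))))
                              (range 1 (4 + n)))
          (cong (λ z → Rcol 1 ++ Rcol 2 ++ z) (trans (cong (concatMap Rcol) (range-snoc 3 (1 + n)))
             (trans (concatMap-++ Rcol (range 3 (1 + n)) ((4 + n) ∷ []))
               (trans (cong (λ z → Rcols₃ ++ map (λ i → R i (4 + n)) (range (6 + n) z) ++ []) (n∸n≡0 (4 + n)))
                      (++-identityʳ Rcols₃))))))))

  tailSplitsₖ : List Split
  tailSplitsₖ = tailSplits k (revPrefix k)

  Fsplits Ssplits Rsplits : List Split
  Fsplits = concatMap (λ i → map (F i) (rangeDesc 1 i)) I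
  Ssplits = concatMap (λ i → map (S i) (rangeDesc 1 i)) I
  Rsplits = concatMap (λ i → map (R i) (rangeDesc 1 (i ∸ 2))) I

  blockSplits-by-position-↭ : concatMap (λ i → blockSplits i (revPrefix i) (suffixAfter k i)) I ↭
    concat (map E₀ I ∷ Fsplits ∷ map E₁ I ∷ map E₂ I ∷ map E₃ I ∷ Ssplits ∷ map E₄ I ∷ map E₅ I ∷ Rsplits ∷ [])
  blockSplits-by-position-↭ =
    ↭-trans (concatMap-∷-↭ E₀ bF I) (++⁺ˡ (map E₀ I)
    (↭-trans (concatMap-++-↭ (λ i → map (F i) (rangeDesc 1 i)) b₀ I) (++⁺ˡ Fsplits
    (↭-trans (concatMap-∷-↭ E₁ b₁ I) (++⁺ˡ (map E₁ I)
    (↭-trans (concatMap-∷-↭ E₂ b₂ I) (++⁺ˡ (map E₂ I)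
    (↭-trans (concatMap-∷-↭ E₃ bS I) (++⁺ˡ (map E₃ I)
    (↭-trans (concatMap-++-↭ (λ i → map (S i) (rangeDesc 1 i)) b₃ I) (++⁺ˡ Ssplits
    (↭-trans (concatMap-∷-↭ E₄ b₄ I) (++⁺ˡ (map E₄ I)
    (↭-trans (concatMap-∷-↭ E₅ b₅ I) (++⁺ˡ (map E₅ I)
    (↭-reflexive (sym (++-identityʳ Rsplits))))))))))))))))))
    where
    b₅ b₄ b₃ bS b₂ b₁ b₀ bF : ℕ → List Split
    b₅ i = map (R i) (rangeDesc 1 (i ∸ 2))
    b₄ i = E₅ i ∷ b₅ i
    b₃ i = E₄ i ∷ b₄ i
    bS i = map (S i) (rangeDesc 1 i) ++ b₃ i
    b₂ i = E₃ i ∷ bS i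
    b₁ i = E₂ i ∷ b₂ i
    b₀ i = E₁ i ∷ b₁ i
    bF i = map (F i) (rangeDesc 1 i) ++ b₀ i

  chunksByPosition : List (List Split)
  chunksByPosition =
    map E₀ I ∷ Fcols ∷ map F₁ I ∷ map E₁ I ∷ map E₂ I ∷ map E₃ I ∷ Scols ∷ map S₁ I ∷ map E₄ I ∷ map E₅ I ∷
    Rcol 1 ∷ Rcol 2 ∷ Rcols₃ ∷ (T₀ ∷ []) ∷ (Tb 1 ∷ []) ∷ Tbs ∷ (Ta ∷ []) ∷ (T$ ∷ []) ∷ []

  allSplits-↭-chunksByPosition : allSplits k ↭ concat chunksByPosition
  allSplits-↭-chunksByPosition =
    ↭-trans (++⁺ʳ tailSplitsₖ blockSplits-by-position-↭)
    (↭-trans (↭-reflexive (trans (cong (concat byPos ++_) (sym (++-identityʳ tailSplitsₖ))) (concat-++ byPos (tailSplitsₖ ∷ []))))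
    (↭-trans (concat-expand-↭ (map E₀ I ∷ []) {Fsplits} (Fcols ∷ map F₁ I ∷ [])
                (map E₁ I ∷ map E₂ I ∷ map E₃ I ∷ Ssplits ∷ map E₄ I ∷ map E₅ I ∷ Rsplits ∷ tailSplitsₖ ∷ [])
                (two {Fcols} {map F₁ I} (triangle-cols-↭ F)))
    (↭-trans (concat-expand-↭ (map E₀ I ∷ Fcols ∷ map F₁ I ∷ map E₁ I ∷ map E₂ I ∷ map E₃ I ∷ []) {Ssplits} (Scols ∷ map S₁ I ∷ [])
                (map E₄ I ∷ map E₅ I ∷ Rsplits ∷ tailSplitsₖ ∷ [])
                (two {Scols} {map S₁ I} (triangle-cols-↭ S)))
    (↭-trans (concat-expand-↭ (map E₀ I ∷ Fcols ∷ map F₁ I ∷ map E₁ I ∷ map E₂ I ∷ map E₃ I ∷ Scols ∷ map S₁ I ∷ map E₄ I ∷ map E₅ I ∷ [])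
                {Rsplits} (Rcol 1 ∷ Rcol 2 ∷ Rcols₃ ∷ []) (tailSplitsₖ ∷ [])
                (↭-trans triangle-Rcols-↭ (↭-reflexive (cong (λ z → Rcol 1 ++ Rcol 2 ++ z) (sym (++-identityʳ Rcols₃))))))
    (concat-expand-↭ (map E₀ I ∷ Fcols ∷ map F₁ I ∷ map E₁ I ∷ map E₂ I ∷ map E₃ I ∷ Scols ∷ map S₁ I ∷ map E₄ I ∷ map E₅ I ∷
                      Rcol 1 ∷ Rcol 2 ∷ Rcols₃ ∷ []) {tailSplitsₖ}
                ((T₀ ∷ []) ∷ (Tb 1 ∷ []) ∷ Tbs ∷ (Ta ∷ []) ∷ (T$ ∷ []) ∷ []) [] tail-↭)))))
    where
    byPos = map E₀ I ∷ Fsplits ∷ map E₁ I ∷ map E₂ I ∷ map E₃ I ∷ Ssplits ∷ map E₄ I ∷ map E₅ I ∷ Rsplits ∷ []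
    tail-↭ : tailSplitsₖ ↭ concat ((T₀ ∷ []) ∷ (Tb 1 ∷ []) ∷ Tbs ∷ (Ta ∷ []) ∷ (T$ ∷ []) ∷ [])
    tail-↭ = prep T₀ (++⁺ʳ {ys = map Tb (range 1 k)} (Ta ∷ T$ ∷ []) (map-rangeDesc-↭ Tb 1 k))

  private
    regroup-pairs-↭ : ∀ {X : Set} (r e rk : X) (Rs Es : List X) →
                      r ∷ e ∷ ((Rs ++ Es) ++ rk ∷ []) ↭ e ∷ (Es ++ (r ∷ (Rs ++ rk ∷ [])))
    regroup-pairs-↭ r e rk Rs Es = ↭-trans (↭-reflexive (cong (λ z → r ∷ e ∷ z) (++-assoc Rs Es _)))
      (↭-sym (concat-permuteBy-↭ (1 ∷ 2 ∷ 0 ∷ 0 ∷ 0 ∷ []) ((r ∷ []) ∷ (e ∷ []) ∷ Rs ∷ Es ∷ (rk ∷ []) ∷ [])))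

  groupA₃-↭ : groupA 3 ↭ map E₁ I ++ Rcol 2
  groupA₃-↭ =
    ↭-trans (prep (E₁ 2) (prep (E₁ 3) (prep (E₁ 4) (prep (R 4 2) (prep (E₁ 5)
      (++⁺ʳ (R (5 + n) 2 ∷ []) (↭-trans (concatMap-∷-↭ (λ i → R i 2) (λ i → E₁ (suc i) ∷ []) (range 5 n))
         (++⁺ˡ (map (λ i → R i 2) (range 5 n))
           (↭-reflexive (trans (concatMap-[-] (λ i → E₁ (suc i)) (range 5 n)) (sym (map-range-suc E₁ 5 n))))))))))))
    (prep (E₁ 2) (prep (E₁ 3) (prep (E₁ 4)
      (↭-trans (regroup-pairs-↭ (R 4 2) (E₁ 5) (R (5 + n) 2) (map (λ i → R i 2) (range 5 n)) (map E₁ (range 6 n)))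
        (↭-reflexive (cong (λ z → E₁ 5 ∷ (map E₁ (range 6 n) ++ (R 4 2 ∷ z)))
           (sym (trans (cong (map (λ i → R i 2)) (range-snoc 5 n)) (map-++ (λ i → R i 2) (range 5 n) _)))))))))

  groupA₂-↭ : groupA 2 ↭ map E₂ I ++ Rcol 1
  groupA₂-↭ =
    ↭-trans (prep (E₂ 2) (prep (E₂ 3) (prep (R 3 1) (prep (E₂ 4)
      (++⁺ʳ (R (5 + n) 1 ∷ []) (↭-trans (concatMap-∷-↭ (λ i → R i 1) (λ i → E₂ (suc i) ∷ []) (range 4 (1 + n)))
         (++⁺ˡ (map (λ i → R i 1) (range 4 (1 + n)))
           (↭-reflexive (trans (concatMap-[-] (λ i → E₂ (suc i)) (range 4 (1 + n))) (sym (map-range-suc E₂ 4 (1 + n))))))))))))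
    (prep (E₂ 2) (prep (E₂ 3)
      (↭-trans (regroup-pairs-↭ (R 3 1) (E₂ 4) (R (5 + n) 1) (map (λ i → R i 1) (range 4 (1 + n))) (map E₂ (range 5 (1 + n))))
        (↭-reflexive (cong (λ z → E₂ 4 ∷ (map E₂ (range 5 (1 + n)) ++ (R 3 1 ∷ z)))
           (sym (trans (cong (map (λ i → R i 1)) (range-snoc 4 (1 + n))) (map-++ (λ i → R i 1) (range 4 (1 + n)) _))))))))

  groupA₁-↭ : groupA 1 ↭ map E₄ I ++ (map E₀ I ++ (map E₃ I ++ T₀ ∷ []))
  groupA₁-↭ = ++⁺ (map-rangeDesc-↭ E₄ 2 (4 + n))
    (↭-trans (prep (E₀ 2) (prep (E₃ 2) (prep (E₀ 3) (prep (E₃ 3)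
               (++⁺ʳ (T₀ ∷ []) (concatMap-∷-↭ E₀ (λ i → E₃ i ∷ []) (range 4 (2 + n))))))))
      (↭-trans (↭-reflexive (cong (λ z → E₀ 2 ∷ E₃ 2 ∷ E₀ 3 ∷ E₃ 3 ∷ z) (++-assoc A₀ A₃ _)))
        (↭-trans (↭-sym (concat-permuteBy-↭ (0 ∷ 1 ∷ 2 ∷ 0 ∷ 0 ∷ 0 ∷ 0 ∷ [])
                   ((E₀ 2 ∷ []) ∷ (E₃ 2 ∷ []) ∷ (E₀ 3 ∷ []) ∷ (E₃ 3 ∷ []) ∷ A₀ ∷ A₃ ∷ (T₀ ∷ []) ∷ [])))
          (↭-reflexive (cong (λ z → E₀ 2 ∷ E₀ 3 ∷ (A₀ ++ (E₃ 2 ∷ E₃ 3 ∷ (z ++ T₀ ∷ []))))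
                             (concatMap-[-] E₃ (range 4 (2 + n))))))))
    where
    A₀ = map E₀ (range 4 (2 + n))
    A₃ = concatMap (λ i → E₃ i ∷ []) (range 4 (2 + n))

  groupsA₄-↭ : concatMap groupA (rangeDesc 4 (1 + n)) ↭ Rcols₃
  groupsA₄-↭ = ↭-trans (concatMap-rangeDesc-↭ groupA 4 (1 + n)) (↭-reflexive (groupA-Rcol 0 (1 + n)))
    where
    groupA-Rcol : ∀ s N → concatMap groupA (range (4 + s) N) ≡ concatMap Rcol (range (3 + s) N)
    groupA-Rcol s zero = refl
    groupA-Rcol s (suc N) = cong (Rcol (3 + s) ++_) (groupA-Rcol (suc s) N)

  chunksA : List (List Split)
  chunksA = Rcols₃ ∷ map E₁ I ∷ Rcol 2 ∷ map E₂ I ∷ Rcol 1 ∷ map E₄ I ∷ map E₀ I ∷ map E₃ I ∷ (T₀ ∷ []) ∷ []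

  groupsA-↭ : concatMap groupA (rangeDesc 1 (4 + n)) ↭ concat chunksA
  groupsA-↭ =
    ↭-trans (↭-reflexive (trans (cong (λ m → concatMap groupA (rangeDesc 1 m)) (+-comm 3 (1 + n)))
                              (trans (cong (concatMap groupA) (rangeDesc-++ 1 (1 + n) 3))
                                     (concatMap-++ groupA (rangeDesc 4 (1 + n)) (3 ∷ 2 ∷ 1 ∷ [])))))
    (++⁺ groupsA₄-↭ (↭-trans (++-↭-assoc {Y = map E₁ I} {Rcol 2} (groupA 2 ++ groupA 1 ++ []) groupA₃-↭)
       (++⁺ˡ (map E₁ I) (++⁺ˡ (Rcol 2) (↭-trans (++-↭-assoc {Y = map E₂ I} {Rcol 1} (groupA 1 ++ []) groupA₂-↭)
         (++⁺ˡ (map E₂ I) (++⁺ˡ (Rcol 1) (↭-trans (↭-reflexive (++-identityʳ (groupA 1))) groupA₁-↭))))))))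

  groupB₁-↭ : groupB 1 ↭ Tb 1 ∷ (map E₅ I ++ (map F₁ I ++ map S₁ I))
  groupB₁-↭ = prep (Tb 1)
    (↭-trans (++⁺ (map-rangeDesc-↭ E₅ 5 (1 + n)) (prep (F₁ 2) (prep (F₁ 3) (prep (F₁ 4) (prep (E₅ 4)
               (++⁺ˡ (map F₁ (range 5 (1 + n))) (prep (E₅ 3) (++⁺ʳ (E₅ 2 ∷ []) (map-rangeDesc-↭ S₁ 2 (4 + n))))))))))
      (↭-trans (↭-sym (concat-permuteBy-↭ (8 ∷ 6 ∷ 4 ∷ 0 ∷ 0 ∷ 0 ∷ 0 ∷ 0 ∷ 0 ∷ [])
                 (E5s ∷ (F₁ 2 ∷ []) ∷ (F₁ 3 ∷ []) ∷ (F₁ 4 ∷ []) ∷ (E₅ 4 ∷ []) ∷ F1s ∷ (E₅ 3 ∷ []) ∷ map S₁ I ∷ (E₅ 2 ∷ []) ∷ [])))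
        (↭-reflexive (cong (λ z → E₅ 2 ∷ E₅ 3 ∷ E₅ 4 ∷ (E5s ++ (F₁ 2 ∷ F₁ 3 ∷ F₁ 4 ∷ (F1s ++ z)))) (++-identityʳ (map S₁ I))))))
    where
    E5s = map E₅ (range 5 (1 + n))
    F1s = map F₁ (range 5 (1 + n))

  groupsB₂-↭ : concatMap groupB (range 2 (5 + n)) ↭ Tbs ++ (Fcols ++ (Scols ++ []))
  groupsB₂-↭ =
    ↭-trans (↭-reflexive (groupB-cols 0 (5 + n)))
    (↭-trans (concatMap-∷-↭ Tb (λ j → Fcol j ++ ScolDesc j) (range 2 (5 + n)))
    (++⁺ˡ Tbs (↭-trans (concatMap-++-↭ Fcol ScolDesc (range 2 (5 + n))) (++⁺ˡ Fcols
      (↭-trans (concatMap-↭ ScolDesc Scol (range 2 (5 + n)) (λ j → map-rangeDesc-↭ (λ i → S i j) j (k ∸ j)))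
               (↭-reflexive (sym (++-identityʳ Scols))))))))
    where
    colsB : ℕ → List Split
    colsB j = Tb j ∷ (Fcol j ++ ScolDesc j)
    groupB-cols : ∀ s N → concatMap groupB (range (2 + s) N) ≡ concatMap colsB (range (2 + s) N)
    groupB-cols s zero = refl
    groupB-cols s (suc N) = cong (colsB (2 + s) ++_) (groupB-cols (suc s) N)

  chunksB : List (List Split)
  chunksB = (Tb 1 ∷ []) ∷ map E₅ I ∷ map F₁ I ∷ map S₁ I ∷ Tbs ∷ Fcols ∷ Scols ∷ []

  groupsB-↭ : concatMap groupB (range 1 k) ↭ concat chunksB
  groupsB-↭ = ↭-trans (++⁺ʳ (concatMap groupB (range 2 (5 + n))) groupB₁-↭)
    (prep (Tb 1) (↭-trans (↭-reflexive (trans (++-assoc (map E₅ I) _ _) (cong (map E₅ I ++_) (++-assoc (map F₁ I) _ _))))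
       (++⁺ˡ (map E₅ I) (++⁺ˡ (map F₁ I) (++⁺ˡ (map S₁ I) groupsB₂-↭)))))

  sortedSplits-↭-chunks : sortedSplits ↭ concat ((T$ ∷ []) ∷ (Ta ∷ []) ∷ chunksA ++ chunksB)
  sortedSplits-↭-chunks =
    prep T$ (prep Ta (↭-trans (++⁺ groupsA-↭ groupsB-↭) (↭-reflexive (concat-++ chunksA chunksB))))

  allSplits-↭-sortedSplits : allSplits k ↭ sortedSplits
  allSplits-↭-sortedSplits =
    ↭-trans allSplits-↭-chunksByPosition
      (↭-trans (concat-permuteBy-↭ (8 ∷ 15 ∷ 12 ∷ 3 ∷ 4 ∷ 6 ∷ 11 ∷ 9 ∷ 5 ∷ 7 ∷ 4 ∷ 3 ∷ 2 ∷ 2 ∷ 2 ∷ 2 ∷ 1 ∷ 0 ∷ [])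
                                   ((T$ ∷ []) ∷ (Ta ∷ []) ∷ chunksA ++ chunksB))
               (↭-sym sortedSplits-↭-chunks))

-- Lexicographic order and sorted groups

infix 4 _⊏_
data _⊏_ : Word → Word → Set where
  here : ∀ {x y u v} → (x <ˢ y) ≡ true → (x ∷ u) ⊏ (y ∷ v)
  there : ∀ {x u v} → u ⊏ v → (x ∷ u) ⊏ (x ∷ v)

⊏-++ : ∀ {u v} p q → u ⊏ v → (u ++ p) ⊏ (v ++ q)
⊏-++ p q (here e) = here e
⊏-++ p q (there h) = there (⊏-++ p q h)

<ˢ-trans : ∀ x y z → (x <ˢ y) ≡ true → (y <ˢ z) ≡ true → (x <ˢ z) ≡ true
<ˢ-trans $ a b p q = refl
<ˢ-trans $ $ z () q
<ˢ-trans $ b z p ()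
<ˢ-trans a a z () q
<ˢ-trans a b z p ()
<ˢ-trans a $ z () q
<ˢ-trans b y z () q

⊏-trans : ∀ {u v w} → u ⊏ v → v ⊏ w → u ⊏ w
⊏-trans {x ∷ _} {y ∷ _} {z ∷ _} (here e) (here f) = here (<ˢ-trans x y z e f)
⊏-trans (here e) (there h) = here e
⊏-trans (there h) (here f) = here f
⊏-trans (there h) (there g) = there (⊏-trans h g)

⊏⇒≤ˡ : ∀ {u v} → u ⊏ v → (u ≤ˡ v) ≡ true
⊏⇒≤ˡ {x ∷ u} {y ∷ v} (here e) rewrite e = refl
⊏⇒≤ˡ {$ ∷ u} (there h) = ⊏⇒≤ˡ h
⊏⇒≤ˡ {a ∷ u} (there h) = ⊏⇒≤ˡ h
⊏⇒≤ˡ {b ∷ u} (there h) = ⊏⇒≤ˡ h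

⊏-replicate : ∀ (c : Sym) m {u v} → u ⊏ v → (replicate m c ++ u) ⊏ (replicate m c ++ v)
⊏-replicate c zero h = h
⊏-replicate c (suc m) h = there (⊏-replicate c m h)

shorter-run-⊏ : ∀ {c d : Sym} → (d <ˢ c) ≡ true → ∀ i j X Y → i < j → (replicate i c ++ d ∷ X) ⊏ (replicate j c ++ Y)
shorter-run-⊏ e zero (suc j) X Y p = here e
shorter-run-⊏ e (suc i) (suc j) X Y (s≤s p) = there (shorter-run-⊏ e i j X Y p)

longer-run-⊏ : ∀ {c d : Sym} → (c <ˢ d) ≡ true → ∀ i j X Y → i < j → (replicate j c ++ X) ⊏ (replicate i c ++ d ∷ Y)
longer-run-⊏ e zero (suc j) X Y p = here e
longer-run-⊏ e (suc i) (suc j) X Y (s≤s p) = there (longer-run-⊏ e i j X Y p)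

_≺_ : Split → Split → Set
e ≺ f = proj₁ e ⊏ proj₁ f

≺⇒≤ˡ : ∀ {e f} → e ≺ f → (rotation e ≤ˡ rotation f) ≡ true
≺⇒≤ˡ {u , r} {v , s} h = ⊏⇒≤ˡ (⊏-++ (reverse r) (reverse s) h)

SortedSplits : List Split → Set
SortedSplits xs = Sorted (map rotation xs)

data HasPrefix (κ : Word) : Word → Set where
  extends : ∀ rest → HasPrefix κ (κ ++ rest)

HasPrefix-⊏ : ∀ {κ κ′ u v} → κ ⊏ κ′ → HasPrefix κ u → HasPrefix κ′ v → u ⊏ v
HasPrefix-⊏ h (extends r) (extends r′) = ⊏-++ r r′ h

All-concatMap-range : ∀ {A : Set} {P : A → Set} (f : ℕ → List A) s N →
                      (∀ i → s ≤ i → i < s + N → All P (f i)) → All P (concatMap f (range s N))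
All-concatMap-range f s zero h = []
All-concatMap-range f s (suc N) h =
  All.++⁺ (h s ≤-refl (subst (s <_) (sym (+-suc s N)) (s≤s (m≤m+n s N))))
          (All-concatMap-range f (suc s) N (λ i p q → h i (≤-trans (n≤1+n s) p) (subst (i <_) (sym (+-suc s N)) q)))

All-map-range : ∀ {A : Set} {P : A → Set} (f : ℕ → A) s N → (∀ i → s ≤ i → i < s + N → P (f i)) → All P (map f (range s N))
All-map-range f s zero h = []
All-map-range f s (suc N) h =
  h s ≤-refl (subst (s <_) (sym (+-suc s N)) (s≤s (m≤m+n s N)))
  ∷ All-map-range f (suc s) N (λ i p q → h i (≤-trans (n≤1+n s) p) (subst (i <_) (sym (+-suc s N)) q))

All-map-rangeDesc : ∀ {A : Set} {P : A → Set} (f : ℕ → A) s N → (∀ i → s ≤ i → i < s + N → P (f i)) →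
                    All P (map f (rangeDesc s N))
All-map-rangeDesc f s zero h = []
All-map-rangeDesc f s (suc N) h =
  h (s + N) (m≤m+n s N) (subst (s + N <_) (sym (+-suc s N)) ≤-refl)
  ∷ All-map-rangeDesc f s N (λ i p q → h i p (≤-trans q (subst (s + N ≤_) (sym (+-suc s N)) (n≤1+n _))))

AllBelow : List Split → List Split → Set
AllBelow xs ys = All (λ x → All (λ y → x ≺ y) ys) xs

sorted-++ : ∀ xs ys → SortedSplits xs → SortedSplits ys → AllBelow xs ys → SortedSplits (xs ++ ys)
sorted-++ [] ys p q h = q
sorted-++ (x ∷ []) [] p q h = p
sorted-++ (x ∷ []) (y ∷ ys) p q ((hy ∷ _) ∷ []) = ≺⇒≤ˡ {x} {y} hy ∷ q
sorted-++ (x ∷ x′ ∷ xs) ys (e ∷ p) q (_ ∷ h) = e ∷ sorted-++ (x′ ∷ xs) ys p q h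

Group : Set
Group = Word × List Split

KeyedGroup : Group → Set
KeyedGroup (κ , g) = SortedSplits g × All (λ e → HasPrefix κ (proj₁ e)) g

KeysIncreasing : List Group → Set
KeysIncreasing = Linked (λ x y → proj₁ x ⊏ proj₁ y)

KeysIncreasing-head : ∀ {κ g gs} → KeysIncreasing ((κ , g) ∷ gs) → All (λ p → κ ⊏ proj₁ p) gs
KeysIncreasing-head [-] = []
KeysIncreasing-head (h ∷ l) = h ∷ All.map (⊏-trans h) (KeysIncreasing-head l)

sorted-groups : ∀ gs → All KeyedGroup gs → KeysIncreasing gs → SortedSplits (concat (map proj₂ gs))
sorted-groups [] _ _ = []
sorted-groups ((κ , g) ∷ gs) ((sg , kg) ∷ hk) l =
  sorted-++ g (concat (map proj₂ gs)) sg (sorted-groups gs hk (Linked.tail l)) (below g kg)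
  where
  later : ∀ {x} → HasPrefix κ (proj₁ x) → ∀ gs → All (λ p → κ ⊏ proj₁ p) gs → All KeyedGroup gs →
          All (λ y → x ≺ y) (concat (map proj₂ gs))
  later hx [] [] [] = []
  later {x} hx ((κ′ , g′) ∷ gs) (h ∷ ha) ((_ , hk′) ∷ hk) =
    All.++⁺ (All.map (HasPrefix-⊏ h hx) hk′) (later {x} hx gs ha hk)
  below : ∀ g → All (λ e → HasPrefix κ (proj₁ e)) g → AllBelow g (concat (map proj₂ gs))
  below [] [] = []
  below (x ∷ g) (hx ∷ hg) = later {x} hx gs (KeysIncreasing-head l) hk ∷ below g hg

concat-map-proj₂-map : ∀ {X : Set} (f : X → Group) xs → concat (map proj₂ (map f xs)) ≡ concatMap (λ x → proj₂ (f x)) xs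
concat-map-proj₂-map f xs = cong concat (sym (map-∘ xs))

keysIncreasing-map-range : ∀ (f : ℕ → Group) s N → (∀ i → s ≤ i → suc i < s + N → proj₁ (f i) ⊏ proj₁ (f (suc i))) →
                           KeysIncreasing (map f (range s N))
keysIncreasing-map-range f s zero h = []
keysIncreasing-map-range f s (suc zero) h = [-]
keysIncreasing-map-range f s (suc (suc N)) h =
  h s ≤-refl (subst (suc s <_) (sym (+-suc s (suc N))) (s≤s (m<m+n s (s≤s z≤n))))
  ∷ keysIncreasing-map-range f (suc s) (suc N) (λ i p q → h i (≤-trans (n≤1+n s) p) (subst (suc i <_) (sym (+-suc s (suc N))) q))

keysIncreasing-map-rangeDesc-++ : ∀ (f : ℕ → Group) s N {y ys} →
  (∀ i → s ≤ i → suc i < s + suc N → proj₁ (f (suc i)) ⊏ proj₁ (f i)) → proj₁ (f s) ⊏ proj₁ y →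
  KeysIncreasing (y ∷ ys) → KeysIncreasing (map f (rangeDesc s (suc N)) ++ y ∷ ys)
keysIncreasing-map-rangeDesc-++ f s zero {y} h e l = subst (λ z → proj₁ (f z) ⊏ proj₁ y) (sym (+-identityʳ s)) e ∷ l
keysIncreasing-map-rangeDesc-++ f s (suc N) h e l =
  subst (λ z → proj₁ (f z) ⊏ proj₁ (f (s + N))) (sym (+-suc s N))
        (h (s + N) (m≤m+n s N) (subst (suc (suc (s + N)) ≤_) (sym (trans (+-suc s (suc N)) (cong suc (+-suc s N)))) ≤-refl))
  ∷ keysIncreasing-map-rangeDesc-++ f s N (λ i p q → h i p (≤-trans q (subst (s + suc N ≤_) (sym (+-suc s (suc N))) (n≤1+n _)))) e l

≺-cons : ∀ e f {Ls : List Word} → e ≺ f → Sorted (rotation f ∷ Ls) → Sorted (rotation e ∷ rotation f ∷ Ls)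
≺-cons e f h s = ≺⇒≤ˡ {e} {f} h ∷ s

sorted-map-range : ∀ (f : ℕ → Split) s N → (∀ i → s ≤ i → suc i < s + N → f i ≺ f (suc i)) →
                   SortedSplits (map f (range s N))
sorted-map-range f s zero h = []
sorted-map-range f s (suc zero) h = [-]
sorted-map-range f s (suc (suc N)) h =
  ≺-cons (f s) (f (suc s)) (h s ≤-refl (subst (suc s <_) (sym (+-suc s (suc N))) (s≤s (m<m+n s (s≤s z≤n)))))
    (sorted-map-range f (suc s) (suc N) (λ i p q → h i (≤-trans (n≤1+n s) p) (subst (suc i <_) (sym (+-suc s (suc N))) q)))

sorted-map-rangeDesc : ∀ (f : ℕ → Split) s N → (∀ i → s ≤ i → suc i < s + N → f (suc i) ≺ f i) →
                       SortedSplits (map f (rangeDesc s N))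
sorted-map-rangeDesc f s zero h = []
sorted-map-rangeDesc f s (suc zero) h = [-]
sorted-map-rangeDesc f s (suc (suc N)) h =
  ≺-cons (f (s + suc N)) (f (s + N))
    (subst (λ z → f z ≺ f (s + N)) (sym (+-suc s N))
      (h (s + N) (m≤m+n s N) (subst (suc (suc (s + N)) ≤_) (sym (trans (+-suc s (suc N)) (cong suc (+-suc s N)))) ≤-refl)))
    (sorted-map-rangeDesc f s (suc N) (λ i p q → h i p (≤-trans q (subst (s + suc N ≤_) (sym (+-suc s (suc N))) (n≤1+n _)))))

sorted-pairs : ∀ (x y : ℕ → Split) s N → (∀ i → s ≤ i → i < s + N → x i ≺ y i) →
               (∀ i → s ≤ i → suc i < s + N → y i ≺ x (suc i)) →
               SortedSplits (concatMap (λ i → x i ∷ y i ∷ []) (range s N))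
sorted-pairs x y s zero h₁ h₂ = []
sorted-pairs x y s (suc zero) h₁ h₂ = ≺-cons (x s) (y s) (h₁ s ≤-refl (m<m+n s (s≤s z≤n))) [-]
sorted-pairs x y s (suc (suc N)) h₁ h₂ =
  ≺-cons (x s) (y s) (h₁ s ≤-refl (m<m+n s (s≤s z≤n)))
    (≺-cons (y s) (x (suc s)) (h₂ s ≤-refl (subst (suc s <_) (sym (+-suc s (suc N))) (s≤s (m<m+n s (s≤s z≤n)))))
      (sorted-pairs x y (suc s) (suc N) (λ i p q → h₁ i (≤-trans (n≤1+n s) p) (subst (i <_) (sym (+-suc s (suc N))) q))
                                        (λ i p q → h₂ i (≤-trans (n≤1+n s) p) (subst (suc i <_) (sym (+-suc s (suc N))) q))))

-- The suffix that follows block i (the next block, or the tail word): a bⁱ⁺¹ a c … with c < b.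
data NextBlock (i : ℕ) : Word → Set where
  nextBlock : ∀ c Z → (c <ˢ b) ≡ true → NextBlock i (a ∷ ((b ^ˢ (suc i)) ++ a ∷ c ∷ Z))

infix 4 _⊑_
data _⊑_ : Word → Word → Set where
  strict : ∀ {u v} → u ⊏ v → u ⊑ v
  prefix : ∀ {u} r → u ⊑ (u ++ r)

⊏-++ʳ : ∀ {u v} q → u ⊏ v → u ⊏ (v ++ q)
⊏-++ʳ q (here e) = here e
⊏-++ʳ q (there h) = there (⊏-++ʳ q h)

⊏-⊑-trans : ∀ {x M y} → x ⊏ M → M ⊑ y → x ⊏ y
⊏-⊑-trans h (strict g) = ⊏-trans h g
⊏-⊑-trans h (prefix r) = ⊏-++ʳ r h

prefix-++ : ∀ p q r → (p ++ q) ⊑ (p ++ (q ++ r))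
prefix-++ p q r = subst ((p ++ q) ⊑_) (++-assoc p q r) (prefix r)

AllBelow-via : ∀ M xs ys → All (λ x → proj₁ x ⊏ M) xs → All (λ y → M ⊑ proj₁ y) ys → AllBelow xs ys
AllBelow-via M [] ys hx hy = []
AllBelow-via M (x ∷ xs) ys (h ∷ hx) hy = All.map (⊏-⊑-trans h) hy ∷ AllBelow-via M xs ys hx hy

a-run-NextBlock : ∀ {i V} m → NextBlock i V → Σ Word (λ X → (a ^ˢ m) ++ V ≡ (a ^ˢ (suc m)) ++ b ∷ X)
a-run-NextBlock {i} m (nextBlock c Z e) = ((b ^ˢ i) ++ a ∷ c ∷ Z) , replicate-snoc a m _

a-run-NextBlock-head : ∀ {i V} m → NextBlock i V → Σ Word (λ Y → (a ^ˢ m) ++ V ≡ a ∷ Y)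
a-run-NextBlock-head m v with a-run-NextBlock m v
... | X , eq = ((a ^ˢ m) ++ b ∷ X) , eq

HasPrefix-a-run-NextBlock : ∀ {i V} m → NextBlock i V → HasPrefix ((a ^ˢ (suc m)) ++ b ∷ []) ((a ^ˢ m) ++ V)
HasPrefix-a-run-NextBlock m v with a-run-NextBlock m v
... | X , eq = subst (HasPrefix _) (trans (++-assoc (a ^ˢ (suc m)) (b ∷ []) X) (sym eq)) (extends X)

HasPrefix-bʲa : ∀ j X → HasPrefix ((b ^ˢ j) ++ a ∷ []) ((b ^ˢ j) ++ a ∷ X)
HasPrefix-bʲa j X = subst (HasPrefix _) (++-assoc (b ^ˢ j) (a ∷ []) X) (extends X)

NextBlock-⊏ : ∀ {i j V W} → NextBlock i V → NextBlock j W → i < j → V ⊏ W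
NextBlock-⊏ {i} {j} (nextBlock c Z e) (nextBlock c′ Z′ e′) p = there (shorter-run-⊏ {b} {a} refl (suc i) (suc j) _ _ (s≤s p))

a-run-NextBlock-⊏ : ∀ {i j V W} m → NextBlock i V → NextBlock j W → i < j → ((a ^ˢ m) ++ V) ⊏ ((a ^ˢ m) ++ W)
a-run-NextBlock-⊏ m v w p = ⊏-replicate a m (NextBlock-⊏ v w p)

longer-a-run-NextBlock-⊏ : ∀ {i j V W} m m′ → NextBlock i V → NextBlock j W → m′ < m → ((a ^ˢ m) ++ V) ⊏ ((a ^ˢ m′) ++ W)
longer-a-run-NextBlock-⊏ m m′ v w p with a-run-NextBlock m v | a-run-NextBlock m′ w
... | X , e₁ | Y , e₂ rewrite e₁ | e₂ = longer-run-⊏ {a} {b} refl (suc m′) (suc m) _ _ (s≤s p)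

Q₁-⊏-Q₁ : ∀ {i j} V W → i < j → Q₁ i V ⊏ Q₁ j W
Q₁-⊏-Q₁ {i} {j} V W p = there (there (there (shorter-run-⊏ {b} {a} refl i j _ _ p)))

Q₁-⊏-aaNext : ∀ {i j V} W → NextBlock j W → i ≤ j → Q₁ i V ⊏ (a ∷ a ∷ W)
Q₁-⊏-aaNext {i} {j} _ (nextBlock c Z e) p = there (there (there (shorter-run-⊏ {b} {a} refl i (suc j) _ _ (s≤s p))))

aaNext-⊏-Q₁ : ∀ {i V} W → NextBlock i V → (a ∷ a ∷ V) ⊏ Q₁ (suc i) W
aaNext-⊏-Q₁ {i} W (nextBlock c Z e) = there (there (there (⊏-replicate b (suc i) (there (here e)))))

aabQ₂-⊏-aNext : ∀ {i j V} W → NextBlock j W → i ≤ j → (a ∷ a ∷ (b ^ˢ i) ++ Q₂ i V) ⊏ (a ∷ W)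
aabQ₂-⊏-aNext {i} {j} _ (nextBlock c Z e) p = there (there (shorter-run-⊏ {b} {a} refl i (suc j) _ _ (s≤s p)))

aNext-⊏-aabQ₂ : ∀ {i V} W → NextBlock i V → (a ∷ V) ⊏ (a ∷ a ∷ (b ^ˢ (suc i)) ++ Q₂ (suc i) W)
aNext-⊏-aabQ₂ {i} W (nextBlock c Z e) = there (there (⊏-replicate b (suc i) (there (here e))))

aabQ₂-⊏-aabQ₂ : ∀ {i j} V W → i < j → (a ∷ a ∷ (b ^ˢ i) ++ Q₂ i V) ⊏ (a ∷ a ∷ (b ^ˢ j) ++ Q₂ j W)
aabQ₂-⊏-aabQ₂ {i} {j} V W p = there (there (shorter-run-⊏ {b} {a} refl i j _ _ p))

ab-run-⊏ : ∀ {i j} X Y → i < j → (a ∷ (b ^ˢ i) ++ a ∷ X) ⊏ (a ∷ (b ^ˢ j) ++ Y)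
ab-run-⊏ {i} {j} X Y p = there (shorter-run-⊏ {b} {a} refl i j X Y p)

Q₂-⊏-Q₂ : ∀ {t V W} → NextBlock (2 + t) V → NextBlock (3 + t) W → Q₂ (3 + t) W ⊏ Q₂ (2 + t) V
Q₂-⊏-Q₂ {t} v w = there (there (longer-a-run-NextBlock-⊏ (suc t) t w v ≤-refl))

module SortedGroups (n : ℕ) where
  open Layout n

  nextBlock-V : ∀ i → i ≤ 5 + n → NextBlock i (V i)
  nextBlock-V i p = go (5 + n ∸ i) (m+[n∸m]≡n p)
    where
    go : ∀ d → i + d ≡ 5 + n → NextBlock i (blocks (suc i) d ++ tailWord k)
    go zero e = subst (λ z → NextBlock i (a ∷ ((b ^ˢ z) ++ a ∷ $ ∷ []))) (cong suc (trans (sym (+-identityʳ i)) e))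
                      (nextBlock $ [] refl)
    go (suc d) e = subst (NextBlock i) (sym (trans (++-assoc (block (suc i)) (blocks (suc (suc i)) d) (tailWord k))
                                                   (block-++ (suc i) _)))
                         (nextBlock a _ refl)

  nextBlock-V< : ∀ i → i < 6 + n → NextBlock i (V i)
  nextBlock-V< i q = nextBlock-V i (≤-pred q)

  small : ∀ i → i ≤ 5 → i ≤ 5 + n
  small i p = ≤-trans p (m≤m+n 5 n)

  v₂ : NextBlock 2 (V 2)
  v₂ = nextBlock-V 2 (small 2 (s≤s (s≤s z≤n)))
  v₃ : NextBlock 3 (V 3)
  v₃ = nextBlock-V 3 (small 3 (s≤s (s≤s (s≤s z≤n))))
  v₄ : NextBlock 4 (V 4)
  v₄ = nextBlock-V 4 (small 4 (n≤1+n 4))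
  vₖ : NextBlock (5 + n) (V (5 + n))
  vₖ = nextBlock-V (5 + n) ≤-refl

  sorted-groupA₃ : SortedSplits (groupA 3)
  sorted-groupA₃ =
    ≺-cons (E₁ 2) (E₁ 3) (Q₁-⊏-Q₁ {2} {3} (V 2) (V 3) ≤-refl)
    (≺-cons (E₁ 3) (E₁ 4) (Q₁-⊏-Q₁ {3} {4} (V 3) (V 4) ≤-refl)
    (≺-cons (E₁ 4) (R 4 2) (Q₁-⊏-aaNext {4} {4} {V 4} (V 4) v₄ ≤-refl)
    (≺-cons (R 4 2) (E₁ 5) (aaNext-⊏-Q₁ {4} {V 4} (V 5) v₄)
    (sorted-++ (E₁ 5 ∷ []) (pairsRE₁ ++ R (5 + n) 2 ∷ []) [-]
       (sorted-++ pairsRE₁ (R (5 + n) 2 ∷ []) sorted-pairsRE₁ [-] pairs-below-last) (E₁₅-below ∷ [])))))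
    where
    sorted-pairsRE₁ : SortedSplits pairsRE₁
    sorted-pairsRE₁ = sorted-pairs (λ i → R i 2) (λ i → E₁ (suc i)) 5 n
      (λ i p q → aaNext-⊏-Q₁ (V (suc i)) (nextBlock-V i (<⇒≤ q)))
      (λ i p q → Q₁-⊏-aaNext (V (suc i)) (nextBlock-V (suc i) (<⇒≤ q)) ≤-refl)
    pairs-below-last : AllBelow pairsRE₁ (R (5 + n) 2 ∷ [])
    pairs-below-last = All-concatMap-range (λ i → R i 2 ∷ E₁ (suc i) ∷ []) 5 n
      (λ i p q → (a-run-NextBlock-⊏ 2 (nextBlock-V i (<⇒≤ q)) vₖ q ∷ []) ∷ (Q₁-⊏-aaNext (V (5 + n)) vₖ q ∷ []) ∷ [])
    E₁₅-below : All (λ y → E₁ 5 ≺ y) (pairsRE₁ ++ R (5 + n) 2 ∷ [])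
    E₁₅-below = All.++⁺ (All-concatMap-range (λ i → R i 2 ∷ E₁ (suc i) ∷ []) 5 n
        (λ i p q → Q₁-⊏-aaNext (V i) (nextBlock-V i (<⇒≤ q)) p ∷ Q₁-⊏-Q₁ (V 5) (V (suc i)) (s≤s p) ∷ []))
      (Q₁-⊏-aaNext (V (5 + n)) vₖ (small 5 ≤-refl) ∷ [])

  sorted-groupA₂ : SortedSplits (groupA 2)
  sorted-groupA₂ =
    ≺-cons (E₂ 2) (E₂ 3) (aabQ₂-⊏-aabQ₂ {2} {3} (V 2) (V 3) ≤-refl)
    (≺-cons (E₂ 3) (R 3 1) (aabQ₂-⊏-aNext {3} {3} {V 3} (V 3) v₃ ≤-refl)
    (≺-cons (R 3 1) (E₂ 4) (aNext-⊏-aabQ₂ {3} {V 3} (V 4) v₃)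
    (≺-cons (E₂ 4) (R 4 1) (aabQ₂-⊏-aNext {4} {4} {V 4} (V 4) v₄ ≤-refl)
    (sorted-++ pairsRE₂ (R (5 + n) 1 ∷ []) sorted-pairsRE₂ [-] pairs-below-last))))
    where
    sorted-pairsRE₂ : SortedSplits pairsRE₂
    sorted-pairsRE₂ = sorted-pairs (λ i → R i 1) (λ i → E₂ (suc i)) 4 (1 + n)
      (λ i p q → aNext-⊏-aabQ₂ (V (suc i)) (nextBlock-V i (<⇒≤ q)))
      (λ i p q → aabQ₂-⊏-aNext (V (suc i)) (nextBlock-V (suc i) (<⇒≤ q)) ≤-refl)
    pairs-below-last : AllBelow pairsRE₂ (R (5 + n) 1 ∷ [])
    pairs-below-last = All-concatMap-range (λ i → R i 1 ∷ E₂ (suc i) ∷ []) 4 (1 + n)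
      (λ i p q → (a-run-NextBlock-⊏ 1 (nextBlock-V i (<⇒≤ q)) vₖ q ∷ []) ∷ (aabQ₂-⊏-aNext (V (5 + n)) vₖ q ∷ []) ∷ [])

  E₀≺E₃ : ∀ i → E₀ i ≺ E₃ i
  E₀≺E₃ i = there (⊏-replicate b i (there (here refl)))

  E₄-⊏-abb : ∀ i → i < 6 + n → proj₁ (E₄ i) ⊏ (a ∷ b ∷ b ∷ [])
  E₄-⊏-abb i q with a-run-NextBlock-head (i ∸ 2) (nextBlock-V< i q)
  ... | Y , eq rewrite eq = there (there (here refl))

  sorted-groupA₁ : SortedSplits (groupA 1)
  sorted-groupA₁ = sorted-++ E4s rest sorted-E4s sorted-rest
    (AllBelow-via (a ∷ b ∷ b ∷ []) E4s rest (All-map-rangeDesc E₄ 2 (4 + n) (λ i p q → E₄-⊏-abb i q)) abb-⊑-rest)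
    where
    E4s = map E₄ (rangeDesc 2 (4 + n))
    rest = E₀ 2 ∷ E₃ 2 ∷ E₀ 3 ∷ E₃ 3 ∷ (pairsE₀E₃ ++ T₀ ∷ [])
    sorted-E4s : SortedSplits E4s
    sorted-E4s = sorted-map-rangeDesc E₄ 2 (4 + n) step
      where
      step : ∀ i → 2 ≤ i → suc i < 2 + (4 + n) → E₄ (suc i) ≺ E₄ i
      step (suc (suc t)) (s≤s (s≤s p)) q =
        Q₂-⊏-Q₂ {t} (nextBlock-V (2 + t) (<⇒≤ (≤-pred q))) (nextBlock-V (3 + t) (≤-pred q))
    sorted-rest : SortedSplits rest
    sorted-rest =
      ≺-cons (E₀ 2) (E₃ 2) (E₀≺E₃ 2) (≺-cons (E₃ 2) (E₀ 3) (ab-run-⊏ {2} {3} _ _ ≤-refl)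
      (≺-cons (E₀ 3) (E₃ 3) (E₀≺E₃ 3) (≺-cons (E₃ 3) (E₀ 4) (ab-run-⊏ {3} {4} _ _ ≤-refl)
      (sorted-++ pairsE₀E₃ (T₀ ∷ [])
        (sorted-pairs E₀ E₃ 4 (2 + n) (λ i p q → E₀≺E₃ i) (λ i p q → ab-run-⊏ _ _ ≤-refl)) [-]
        (All-concatMap-range (λ i → E₀ i ∷ E₃ i ∷ []) 4 (2 + n)
          (λ i p q → (ab-run-⊏ _ _ q ∷ []) ∷ (ab-run-⊏ _ _ q ∷ []) ∷ []))))))
    abb-⊑-rest : All (λ y → (a ∷ b ∷ b ∷ []) ⊑ proj₁ y) rest
    abb-⊑-rest = prefix _ ∷ prefix _ ∷ prefix _ ∷ prefix _ ∷
      All.++⁺ (All-concatMap-range (λ i → E₀ i ∷ E₃ i ∷ []) 4 (2 + n) f) (prefix _ ∷ [])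
      where
      f : ∀ i → 4 ≤ i → i < 4 + (2 + n) → All (λ y → (a ∷ b ∷ b ∷ []) ⊑ proj₁ y) (E₀ i ∷ E₃ i ∷ [])
      f (suc (suc i)) p q = prefix _ ∷ prefix _ ∷ []
      f (suc zero) (s≤s ()) q

  sorted-Rcol : ∀ m → m ≤ 4 + n → SortedSplits (Rcol m)
  sorted-Rcol m pm = sorted-map-range (λ i → R i m) (2 + m) (4 + n ∸ m)
    (λ i p q → a-run-NextBlock-⊏ m (nextBlock-V i (<⇒≤ (bound q))) (nextBlock-V (suc i) (bound q)) ≤-refl)
    where
    bound : ∀ {i} → suc i < 2 + m + (4 + n ∸ m) → suc i ≤ 5 + n
    bound {i} q = ≤-pred (subst (suc (suc i) ≤_) (cong (2 +_) (m+[n∸m]≡n pm)) q)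

  E₅-step : ∀ i → 2 ≤ i → suc i < 6 + n → E₅ (suc i) ≺ E₅ i
  E₅-step (suc (suc t)) (s≤s (s≤s p)) q =
    there (longer-a-run-NextBlock-⊏ (suc t) t (nextBlock-V (3 + t) (≤-pred q)) (nextBlock-V (2 + t) (<⇒≤ (≤-pred q))) ≤-refl)

  S-step : ∀ j i → 2 ≤ i → suc i < 6 + n → S (suc i) j ≺ S i j
  S-step j (suc (suc t)) (s≤s (s≤s p)) q =
    ⊏-replicate b j (Q₂-⊏-Q₂ {t} (nextBlock-V (2 + t) (<⇒≤ (≤-pred q))) (nextBlock-V (3 + t) (≤-pred q)))

  private
    baaab baab : Word
    baaab = b ∷ a ∷ a ∷ a ∷ b ∷ []
    baab = b ∷ a ∷ a ∷ b ∷ []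

    ⊑-bNext : ∀ {M W} → NextBlock 2 W → M ⊏ (b ∷ a ∷ b ∷ []) → M ⊑ (b ∷ W)
    ⊑-bNext (nextBlock c Z e) h = strict (⊏-++ʳ _ h)

    baab-⊑-groupB₁-tail₂ : All (λ y → baab ⊑ proj₁ y) groupB₁-tail₂
    baab-⊑-groupB₁-tail₂ = baab-⊑-baNext v₃ ∷
      All.++⁺ (All-map-rangeDesc S₁ 2 (4 + n) (λ i p q → strict (there (there (here refl)))))
              (⊑-bNext v₂ (there (there (here refl))) ∷ [])
      where
      baab-⊑-baNext : ∀ {W} → NextBlock 3 W → baab ⊑ (b ∷ a ∷ W)
      baab-⊑-baNext (nextBlock c Z e) = prefix _

    baaab-⊑-groupB₁-tail₁ : All (λ y → baaab ⊑ proj₁ y) groupB₁-tail₁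
    baaab-⊑-groupB₁-tail₁ = prefix _ ∷ prefix _ ∷ prefix _ ∷ baaab-⊑-baaNext v₄ ∷
      All.++⁺ (All-map-range F₁ 5 (1 + n) (λ { (suc i) p q → prefix _ }))
        (baaab-⊑-baNext v₃ ∷ All.++⁺ (All-map-rangeDesc S₁ 2 (4 + n) (λ i p q → strict (there (there (here refl)))))
                                     (⊑-bNext v₂ (there (there (here refl))) ∷ []))
      where
      baaab-⊑-baaNext : ∀ {W} → NextBlock 4 W → baaab ⊑ (b ∷ a ∷ a ∷ W)
      baaab-⊑-baaNext (nextBlock c Z e) = prefix _
      baaab-⊑-baNext : ∀ {W} → NextBlock 3 W → baaab ⊑ (b ∷ a ∷ W)
      baaab-⊑-baNext (nextBlock c Z e) = strict (there (there (there (here refl))))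

  sorted-groupB₁-tail₂ : SortedSplits groupB₁-tail₂
  sorted-groupB₁-tail₂ = ≺-cons (E₅ 3) (S (5 + n) 1) (baNext-⊏-bab _ v₃)
    (sorted-++ S1s (E₅ 2 ∷ []) (sorted-map-rangeDesc S₁ 2 (4 + n) (S-step 1)) [-] (All-map-rangeDesc S₁ 2 (4 + n) S₁-below-E₅₂))
    where
    S1s = map S₁ (rangeDesc 2 (4 + n))
    baNext-⊏-bab : ∀ {W} X → NextBlock 3 W → (b ∷ a ∷ W) ⊏ (b ∷ a ∷ b ∷ X)
    baNext-⊏-bab X (nextBlock c Z e) = there (there (here refl))
    baba-⊏-bNext : ∀ {W} Y → NextBlock 2 W → (b ∷ a ∷ b ∷ a ∷ Y) ⊏ (b ∷ W)
    baba-⊏-bNext Y (nextBlock c Z e) = there (there (there (here refl)))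
    S₁-below-E₅₂ : ∀ i → 2 ≤ i → i < 2 + (4 + n) → All (λ y → S₁ i ≺ y) (E₅ 2 ∷ [])
    S₁-below-E₅₂ i p q with a-run-NextBlock-head (i ∸ 2) (nextBlock-V< i q)
    ... | Y , eq rewrite eq = baba-⊏-bNext Y v₂ ∷ []

  sorted-groupB₁-tail₁ : SortedSplits groupB₁-tail₁
  sorted-groupB₁-tail₁ =
    ≺-cons (F 2 1) (F 3 1) (there (Q₁-⊏-Q₁ {2} {3} _ _ ≤-refl))
    (≺-cons (F 3 1) (F 4 1) (there (Q₁-⊏-Q₁ {3} {4} _ _ ≤-refl))
    (≺-cons (F 4 1) (E₅ 4) (there (Q₁-⊏-aaNext {4} {4} {V 4} (V 4) v₄ ≤-refl))
    (≺-cons (E₅ 4) (F 5 1) (there (aaNext-⊏-Q₁ {4} {V 4} (V 5) v₄))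
    (sorted-++ F1s groupB₁-tail₂ (sorted-map-range F₁ 5 (1 + n) (λ i p q → there (Q₁-⊏-Q₁ _ _ ≤-refl))) sorted-groupB₁-tail₂
               (AllBelow-via baab F1s groupB₁-tail₂ (All-map-range F₁ 5 (1 + n) (λ i p q → there (there (there (here refl)))))
                             baab-⊑-groupB₁-tail₂)))))
    where
    F1s = map F₁ (range 5 (1 + n))

  sorted-groupB₁ : SortedSplits (groupB 1)
  sorted-groupB₁ = ≺-cons (Tb 1) (E₅ (5 + n)) (there (there (here refl)))
    (sorted-++ E5s groupB₁-tail₁ (sorted-map-rangeDesc E₅ 5 (1 + n) (λ i p q → E₅-step i (≤-trans (s≤s (s≤s z≤n)) p) q))
               sorted-groupB₁-tail₁ (AllBelow-via baaab E5s groupB₁-tail₁ (All-map-rangeDesc E₅ 5 (1 + n) E₅-⊏-baaab) baaab-⊑-groupB₁-tail₁))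
    where
    E5s = map E₅ (rangeDesc 5 (1 + n))
    E₅-⊏-baaab : ∀ i → 5 ≤ i → i < 5 + (1 + n) → proj₁ (E₅ i) ⊏ baaab
    E₅-⊏-baaab (suc (suc (suc (suc (suc t))))) p q with a-run-NextBlock-head t (nextBlock-V< (5 + t) q)
    ... | Y , eq rewrite eq = there (there (there (there (here refl))))
    E₅-⊏-baaab (suc zero) (s≤s ()) q
    E₅-⊏-baaab (suc (suc zero)) (s≤s (s≤s ())) q
    E₅-⊏-baaab (suc (suc (suc zero))) (s≤s (s≤s (s≤s ()))) q
    E₅-⊏-baaab (suc (suc (suc (suc zero)))) (s≤s (s≤s (s≤s (s≤s ())))) q

  sorted-groupB : ∀ j → 2 ≤ j → j ≤ 6 + n → SortedSplits (groupB j)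
  sorted-groupB (suc zero) (s≤s ()) qj
  sorted-groupB (suc (suc j′)) pj qj =
    sorted-++ (Tb j ∷ []) (Fcol j ++ ScolDesc j) [-]
      (sorted-++ (Fcol j) (ScolDesc j) sorted-Fcol sorted-ScolDesc (AllBelow-via bʲab (Fcol j) (ScolDesc j) Fcol-⊏ ⊑-ScolDesc))
      (AllBelow-via bʲaa (Tb j ∷ []) (Fcol j ++ ScolDesc j) (⊏-replicate b j (there (here refl)) ∷ [])
                    (All.++⁺ ⊑-Fcol ⊑-ScolDesc′))
    where
    j = suc (suc j′)
    bʲaa = (b ^ˢ j) ++ a ∷ a ∷ []
    bʲab = (b ^ˢ j) ++ a ∷ b ∷ []
    bound : ∀ {i} → i < j + (k ∸ j) → i < 6 + n
    bound {i} q = subst (suc i ≤_) (m+[n∸m]≡n qj) q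
    sorted-Fcol : SortedSplits (Fcol j)
    sorted-Fcol = sorted-map-range (λ i → F i j) j (k ∸ j) (λ i p q → ⊏-replicate b j (Q₁-⊏-Q₁ _ _ ≤-refl))
    sorted-ScolDesc : SortedSplits (ScolDesc j)
    sorted-ScolDesc = sorted-map-rangeDesc (λ i → S i j) j (k ∸ j) (λ i p q → S-step j i (≤-trans pj p) (bound q))
    Fcol-⊏ : All (λ x → proj₁ x ⊏ bʲab) (Fcol j)
    Fcol-⊏ = All-map-range (λ i → F i j) j (k ∸ j) (λ i p q → ⊏-replicate b j (there (here refl)))
    ⊑-ScolDesc : All (λ y → bʲab ⊑ proj₁ y) (ScolDesc j)
    ⊑-ScolDesc = All-map-rangeDesc (λ i → S i j) j (k ∸ j) (λ i p q → prefix-++ (b ^ˢ j) (a ∷ b ∷ []) _)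
    ⊑-Fcol : All (λ y → bʲaa ⊑ proj₁ y) (Fcol j)
    ⊑-Fcol = All-map-range (λ i → F i j) j (k ∸ j) (λ i p q → prefix-++ (b ^ˢ j) (a ∷ a ∷ []) _)
    ⊑-ScolDesc′ : All (λ y → bʲaa ⊑ proj₁ y) (ScolDesc j)
    ⊑-ScolDesc′ = All-map-rangeDesc (λ i → S i j) j (k ∸ j) (λ i p q → strict (⊏-replicate b j (there (here refl))))

  hasPrefix-groupA₁ : All (λ e → HasPrefix (a ∷ b ∷ []) (proj₁ e)) (groupA 1)
  hasPrefix-groupA₁ = All.++⁺ (All-map-rangeDesc E₄ 2 (4 + n) (λ i p q → extends _))
    (extends _ ∷ extends _ ∷ extends _ ∷ extends _ ∷
     All.++⁺ (All-concatMap-range (λ i → E₀ i ∷ E₃ i ∷ []) 4 (2 + n) (λ { (suc i) p q → extends _ ∷ extends _ ∷ [] }))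
             (extends _ ∷ []))

  hasPrefix-groupA₂ : All (λ e → HasPrefix (a ∷ a ∷ b ∷ []) (proj₁ e)) (groupA 2)
  hasPrefix-groupA₂ = extends _ ∷ extends _ ∷ HasPrefix-a-run-NextBlock 1 v₃ ∷ extends _ ∷
    All.++⁺ (All-concatMap-range (λ i → R i 1 ∷ E₂ (suc i) ∷ []) 4 (1 + n)
               (λ i p q → HasPrefix-a-run-NextBlock 1 (nextBlock-V i (<⇒≤ q)) ∷ extends _ ∷ []))
            (HasPrefix-a-run-NextBlock 1 vₖ ∷ [])

  hasPrefix-groupA₃ : All (λ e → HasPrefix (a ∷ a ∷ a ∷ b ∷ []) (proj₁ e)) (groupA 3)
  hasPrefix-groupA₃ = extends _ ∷ extends _ ∷ extends _ ∷ HasPrefix-a-run-NextBlock 2 v₄ ∷ extends _ ∷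
    All.++⁺ (All-concatMap-range (λ i → R i 2 ∷ E₁ (suc i) ∷ []) 5 n
               (λ i p q → HasPrefix-a-run-NextBlock 2 (nextBlock-V i (<⇒≤ q)) ∷ extends _ ∷ []))
            (HasPrefix-a-run-NextBlock 2 vₖ ∷ [])

  hasPrefix-Rcol : ∀ m → m ≤ 4 + n → All (λ e → HasPrefix ((a ^ˢ (suc m)) ++ b ∷ []) (proj₁ e)) (Rcol m)
  hasPrefix-Rcol m pm = All-map-range (λ i → R i m) (2 + m) (4 + n ∸ m)
    (λ i p q → HasPrefix-a-run-NextBlock m (nextBlock-V i (≤-pred (subst (suc i ≤_) (cong (2 +_) (m+[n∸m]≡n pm)) q))))

  keyed-groupA : ∀ m → 1 ≤ m → m ≤ 4 + n → KeyedGroup ((a ^ˢ m) ++ b ∷ [] , groupA m)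
  keyed-groupA (suc zero) p q = sorted-groupA₁ , hasPrefix-groupA₁
  keyed-groupA (suc (suc zero)) p q = sorted-groupA₂ , hasPrefix-groupA₂
  keyed-groupA (suc (suc (suc zero))) p q = sorted-groupA₃ , hasPrefix-groupA₃
  keyed-groupA (suc (suc (suc (suc m)))) p q = sorted-Rcol (3 + m) (≤-trans (n≤1+n _) q) , hasPrefix-Rcol (3 + m) (≤-trans (n≤1+n _) q)

  hasPrefix-E₅ : ∀ i → i < 6 + n → HasPrefix (b ∷ a ∷ []) (proj₁ (E₅ i))
  hasPrefix-E₅ i q with a-run-NextBlock-head (i ∸ 2) (nextBlock-V< i q)
  ... | Y , eq rewrite eq = extends Y

  hasPrefix-groupB₁ : All (λ e → HasPrefix (b ∷ a ∷ []) (proj₁ e)) (groupB 1)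
  hasPrefix-groupB₁ = extends _ ∷ All.++⁺ (All-map-rangeDesc E₅ 5 (1 + n) (λ i p q → hasPrefix-E₅ i q))
    (extends _ ∷ extends _ ∷ extends _ ∷ hasPrefix-E₅ 4 (s≤s v₄-bound) ∷
     All.++⁺ (All-map-range F₁ 5 (1 + n) (λ i p q → extends _))
       (hasPrefix-E₅ 3 (s≤s v₃-bound) ∷ All.++⁺ (All-map-rangeDesc S₁ 2 (4 + n) (λ i p q → extends _))
         (hasPrefix-E₅ 2 (s≤s v₂-bound) ∷ [])))
    where
    v₂-bound = small 2 (s≤s (s≤s z≤n))
    v₃-bound = small 3 (s≤s (s≤s (s≤s z≤n)))
    v₄-bound = small 4 (n≤1+n 4)

  hasPrefix-groupB : ∀ j → 2 ≤ j → All (λ e → HasPrefix ((b ^ˢ j) ++ a ∷ []) (proj₁ e)) (groupB j)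
  hasPrefix-groupB (suc zero) (s≤s ())
  hasPrefix-groupB (suc (suc j′)) p = HasPrefix-bʲa j ($ ∷ []) ∷
    All.++⁺ (All-map-range (λ i → F i j) j (k ∸ j) (λ i p q → HasPrefix-bʲa j _))
            (All-map-rangeDesc (λ i → S i j) j (k ∸ j) (λ i p q → HasPrefix-bʲa j _))
    where j = suc (suc j′)

  keyed-groupB : ∀ j → 1 ≤ j → j ≤ 6 + n → KeyedGroup ((b ^ˢ j) ++ a ∷ [] , groupB j)
  keyed-groupB (suc zero) p q = sorted-groupB₁ , hasPrefix-groupB₁
  keyed-groupB (suc (suc j)) p q = sorted-groupB (suc (suc j)) (s≤s (s≤s z≤n)) q , hasPrefix-groupB (suc (suc j)) (s≤s (s≤s z≤n))

module SortedConjugates (n : ℕ) where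
  open Layout n
  open SortedGroups n

  groupAᵏ groupBᵏ : ℕ → Group
  groupAᵏ m = ((a ^ˢ m) ++ b ∷ [] , groupA m)
  groupBᵏ j = ((b ^ˢ j) ++ a ∷ [] , groupB j)

  groups : List Group
  groups = ($ ∷ [] , T$ ∷ []) ∷ (a ∷ $ ∷ [] , Ta ∷ []) ∷ (map groupAᵏ (rangeDesc 1 (4 + n)) ++ map groupBᵏ (range 1 k))

  concat-groups : concat (map proj₂ groups) ≡ sortedSplits
  concat-groups = cong (λ z → T$ ∷ Ta ∷ z)
    (trans (cong concat (map-++ proj₂ (map groupAᵏ (rangeDesc 1 (4 + n))) (map groupBᵏ (range 1 k))))
      (trans (sym (concat-++ (map proj₂ (map groupAᵏ (rangeDesc 1 (4 + n)))) (map proj₂ (map groupBᵏ (range 1 k)))))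
        (cong₂ _++_ (concat-map-proj₂-map groupAᵏ (rangeDesc 1 (4 + n))) (concat-map-proj₂-map groupBᵏ (range 1 k)))))

  keysIncreasing-groups : KeysIncreasing groups
  keysIncreasing-groups = here refl ∷ there (here refl) ∷
    keysIncreasing-map-rangeDesc-++ groupAᵏ 1 (3 + n)
      (λ i p q → longer-run-⊏ {a} {b} refl i (suc i) (b ∷ []) [] ≤-refl) (here refl)
      (keysIncreasing-map-range groupBᵏ 1 k (λ i p q → shorter-run-⊏ {b} {a} refl i (suc i) [] (a ∷ []) ≤-refl))

  keyed-groups : All KeyedGroup groups
  keyed-groups = ([-] , extends [] ∷ []) ∷ ([-] , extends [] ∷ []) ∷
    All.++⁺ (All-map-rangeDesc groupAᵏ 1 (4 + n) (λ i p q → keyed-groupA i p (≤-pred q)))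
            (All-map-range groupBᵏ 1 k (λ i p q → keyed-groupB i p (≤-pred q)))

  sorted-sortedSplits : SortedSplits sortedSplits
  sorted-sortedSplits = subst SortedSplits concat-groups (sorted-groups groups keyed-groups keysIncreasing-groups)

  sortedConjugates-w$ : sortedConjugates (w$ k) ≡ map rotation sortedSplits
  sortedConjugates-w$ = sortWords-unique
    (subst (_↭ map rotation sortedSplits) (sym (conjugates-w$ (4 + n)))
           (map⁺ rotation {allSplits k} {sortedSplits} (Regrouping.allSplits-↭-sortedSplits n)))
    sorted-sortedSplits

-- β and last letters

isPrefix-++ : ∀ κ r → isPrefix κ (κ ++ r) ≡ true
isPrefix-++ [] r = refl
isPrefix-++ ($ ∷ κ) r = isPrefix-++ κ r
isPrefix-++ (a ∷ κ) r = isPrefix-++ κ r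
isPrefix-++ (b ∷ κ) r = isPrefix-++ κ r

==ˢ-refl : ∀ x → (x ==ˢ x) ≡ true
==ˢ-refl $ = refl
==ˢ-refl a = refl
==ˢ-refl b = refl

<ˢ⇒≢ : ∀ x y → (x <ˢ y) ≡ true → (x ==ˢ y) ≡ false
<ˢ⇒≢ $ a e = refl
<ˢ⇒≢ $ b e = refl
<ˢ⇒≢ a b e = refl
<ˢ⇒≢ $ $ ()
<ˢ⇒≢ a $ ()
<ˢ⇒≢ a a ()
<ˢ⇒≢ b y ()

<ˢ⇒≢′ : ∀ x y → (x <ˢ y) ≡ true → (y ==ˢ x) ≡ false
<ˢ⇒≢′ $ a e = refl
<ˢ⇒≢′ $ b e = refl
<ˢ⇒≢′ a b e = refl
<ˢ⇒≢′ $ $ ()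
<ˢ⇒≢′ a $ ()
<ˢ⇒≢′ a a ()
<ˢ⇒≢′ b y ()

data Apart (x κ : Word) : Set where
  below : x ⊏ κ → Apart x κ
  above : κ ⊏ x → Apart x κ

isPrefix-Apart : ∀ {x κ} r → Apart x κ → isPrefix x (κ ++ r) ≡ false
isPrefix-Apart r (below h) = go r h
  where
  go : ∀ {x κ} r → x ⊏ κ → isPrefix x (κ ++ r) ≡ false
  go r (here {x} {y} e) rewrite <ˢ⇒≢ x y e = refl
  go r (there {x} h) rewrite ==ˢ-refl x = go r h
isPrefix-Apart r (above h) = go r h
  where
  go : ∀ {x κ} r → κ ⊏ x → isPrefix x (κ ++ r) ≡ false
  go r (here {x} {y} e) rewrite <ˢ⇒≢′ x y e = refl
  go r (there {x} h) rewrite ==ˢ-refl x = go r h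

filterᵇ-++ : ∀ p xs ys → filterᵇ p (xs ++ ys) ≡ filterᵇ p xs ++ filterᵇ p ys
filterᵇ-++ p [] ys = refl
filterᵇ-++ p (x ∷ xs) ys with p x
... | true = cong (x ∷_) (filterᵇ-++ p xs ys)
... | false = filterᵇ-++ p xs ys

HasPrefix-rotation : ∀ {κ} e → HasPrefix κ (proj₁ e) → HasPrefix κ (rotation e)
HasPrefix-rotation {κ} (_ , s) (extends r) = subst (HasPrefix κ) (sym (++-assoc κ r (reverse s))) (extends (r ++ reverse s))

isPrefix-HasPrefix : ∀ {x w} → HasPrefix x w → isPrefix x w ≡ true
isPrefix-HasPrefix {x} (extends r) = isPrefix-++ x r

isPrefix-Apart-HasPrefix : ∀ {x κ w} → Apart x κ → HasPrefix κ w → isPrefix x w ≡ false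
isPrefix-Apart-HasPrefix c (extends r) = isPrefix-Apart r c

filter-HasPrefix : ∀ x g → All (λ e → HasPrefix x (proj₁ e)) g → filterᵇ (isPrefix x) (map rotation g) ≡ map rotation g
filter-HasPrefix x [] [] = refl
filter-HasPrefix x (e ∷ g) (h ∷ hs) rewrite isPrefix-HasPrefix (HasPrefix-rotation e h) =
  cong (rotation e ∷_) (filter-HasPrefix x g hs)

filter-Apart : ∀ x κ g → Apart x κ → All (λ e → HasPrefix κ (proj₁ e)) g → filterᵇ (isPrefix x) (map rotation g) ≡ []
filter-Apart x κ [] c [] = refl
filter-Apart x κ (e ∷ g) c (h ∷ hs) rewrite isPrefix-Apart-HasPrefix c (HasPrefix-rotation e h) = filter-Apart x κ g c hs

Prefixed : Group → Set
Prefixed (κ , g) = All (λ e → HasPrefix κ (proj₁ e)) g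

filter-Apart-groups : ∀ x gs → All Prefixed gs → All (λ p → Apart x (proj₁ p)) gs →
                      filterᵇ (isPrefix x) (map rotation (concat (map proj₂ gs))) ≡ []
filter-Apart-groups x [] [] [] = refl
filter-Apart-groups x ((κ , g) ∷ gs) (k ∷ ks) (c ∷ cs) =
  trans (cong (filterᵇ (isPrefix x)) (map-++ rotation g (concat (map proj₂ gs))))
    (trans (filterᵇ-++ (isPrefix x) (map rotation g) _)
      (cong₂ _++_ (filter-Apart x κ g c k) (filter-Apart-groups x gs ks cs)))

filter-groups : ∀ x pre g post → All Prefixed pre → All (λ p → Apart x (proj₁ p)) pre →
  All (λ e → HasPrefix x (proj₁ e)) g → All Prefixed post → All (λ p → Apart x (proj₁ p)) post →
  filterᵇ (isPrefix x) (map rotation (concat (map proj₂ (pre ++ (x , g) ∷ post)))) ≡ map rotation g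
filter-groups x pre g post kp cp kg kq cq =
  begin
    filterᵇ (isPrefix x) (map rotation (concat (map proj₂ (pre ++ (x , g) ∷ post))))
  ≡⟨ cong (λ z → filterᵇ (isPrefix x) (map rotation z))
          (trans (cong concat (map-++ proj₂ pre ((x , g) ∷ post))) (sym (concat-++ (map proj₂ pre) _))) ⟩
    filterᵇ (isPrefix x) (map rotation (P ++ (g ++ Q)))
  ≡⟨ cong (filterᵇ (isPrefix x)) (trans (map-++ rotation P _) (cong (map rotation P ++_) (map-++ rotation g Q))) ⟩
    filterᵇ (isPrefix x) (map rotation P ++ (map rotation g ++ map rotation Q))
  ≡⟨ trans (filterᵇ-++ (isPrefix x) (map rotation P) _) (cong (filterᵇ (isPrefix x) (map rotation P) ++_)
                                                              (filterᵇ-++ (isPrefix x) (map rotation g) _)) ⟩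
    filterᵇ (isPrefix x) (map rotation P) ++ (filterᵇ (isPrefix x) (map rotation g) ++ filterᵇ (isPrefix x) (map rotation Q))
  ≡⟨ cong₂ (λ u v → u ++ (v ++ filterᵇ (isPrefix x) (map rotation Q))) (filter-Apart-groups x pre kp cp) (filter-HasPrefix x g kg) ⟩
    map rotation g ++ filterᵇ (isPrefix x) (map rotation Q)
  ≡⟨ trans (cong (map rotation g ++_) (filter-Apart-groups x post kq cq)) (++-identityʳ _) ⟩
    map rotation g
  ∎
  where
  open ≡-Reasoning
  P = concat (map proj₂ pre)
  Q = concat (map proj₂ post)

lastLetters : List Split → Word
lastLetters g = mapMaybe last (map rotation g)

module Beta (n : ℕ) where
  open Layout n
  open SortedGroups n
  open SortedConjugates n

  β-group : ∀ x pre g post → groups ≡ pre ++ (x , g) ∷ post →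
    All Prefixed pre → All (λ p → Apart x (proj₁ p)) pre → All (λ e → HasPrefix x (proj₁ e)) g →
    All Prefixed post → All (λ p → Apart x (proj₁ p)) post → βk k x ≡ lastLetters g
  β-group x pre g post eq kp cp kg kq cq =
    trans (cong (λ z → mapMaybe last (filterᵇ (isPrefix x) z))
                (trans sortedConjugates-w$ (cong (map rotation) (sym concat-groups))))
      (cong (mapMaybe last) (trans (cong (λ z → filterᵇ (isPrefix x) (map rotation (concat (map proj₂ z)))) eq)
                                   (filter-groups x pre g post kp cp kg kq cq)))

  prefixed-A : ∀ s N → 1 ≤ s → s + N ≤ 5 + n → All Prefixed (map groupAᵏ (rangeDesc s N))
  prefixed-A s N p q = All-map-rangeDesc groupAᵏ s N (λ i pi qi → proj₂ (keyed-groupA i (≤-trans p pi) (≤-pred (≤-trans qi q))))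

  prefixed-B : ∀ s N → 1 ≤ s → s + N ≤ 7 + n → All Prefixed (map groupBᵏ (range s N))
  prefixed-B s N p q = All-map-range groupBᵏ s N (λ i pi qi → proj₂ (keyed-groupB i (≤-trans p pi) (≤-pred (≤-trans qi q))))

  apart-B : ∀ x′ s N → 1 ≤ s → All (λ p → Apart (a ∷ x′) (proj₁ p)) (map groupBᵏ (range s N))
  apart-B x′ s N p = All-map-range groupBᵏ s N λ { (suc i) pi qi → below (here refl) ; zero pi qi → contra (≤-trans p pi) }
    where
    contra : 1 ≤ 0 → Apart (a ∷ x′) (proj₁ (groupBᵏ 0))
    contra ()

  a$-⊏-aᵐ⁺¹b : ∀ m → (a ∷ $ ∷ []) ⊏ ((a ^ˢ (suc m)) ++ b ∷ [])
  a$-⊏-aᵐ⁺¹b zero = there (here refl)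
  a$-⊏-aᵐ⁺¹b (suc m) = there (here refl)

  β$ : βk k ($ ∷ []) ≡ lastLetters (T$ ∷ [])
  β$ = β-group ($ ∷ []) [] (T$ ∷ []) _ refl [] [] (extends [] ∷ [])
    ((extends [] ∷ []) ∷ All.++⁺ (prefixed-A 1 (4 + n) ≤-refl ≤-refl) (prefixed-B 1 k ≤-refl ≤-refl))
    (below (here refl) ∷ All.++⁺ (All-map-rangeDesc groupAᵏ 1 (4 + n) λ { (suc i) pi qi → below (here refl) })
                                 (All-map-range groupBᵏ 1 k λ { (suc i) pi qi → below (here refl) }))

  βa$ : βk k (a ∷ $ ∷ []) ≡ lastLetters (Ta ∷ [])
  βa$ = β-group (a ∷ $ ∷ []) (($ ∷ [] , T$ ∷ []) ∷ []) (Ta ∷ []) _ refl ((extends [] ∷ []) ∷ [])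
    (above (here refl) ∷ []) (extends [] ∷ [])
    (All.++⁺ (prefixed-A 1 (4 + n) ≤-refl ≤-refl) (prefixed-B 1 k ≤-refl ≤-refl))
    (All.++⁺ (All-map-rangeDesc groupAᵏ 1 (4 + n) λ { (suc i) pi qi → below (a$-⊏-aᵐ⁺¹b i) })
             (apart-B ($ ∷ []) 1 k ≤-refl))

  βA : ∀ m → suc m ≤ 4 + n → βk k ((a ^ˢ (suc m)) ++ b ∷ []) ≡ lastLetters (groupA (suc m))
  βA m pm = β-group x pre (groupA (suc m)) post groups≡
    ((extends [] ∷ []) ∷ (extends [] ∷ []) ∷ prefixed-A (2 + m) d (s≤s z≤n) (≤-reflexive (cong suc (m+d≡4+n))))
    (above (here refl) ∷ above (a$-⊏-aᵐ⁺¹b m) ∷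
     All-map-rangeDesc groupAᵏ (2 + m) d (λ i pi qi → above (longer-run-⊏ {a} {b} refl (suc m) i (b ∷ []) [] pi)))
    (proj₂ (keyed-groupA (suc m) (s≤s z≤n) pm))
    (All.++⁺ (prefixed-A 1 m ≤-refl (≤-trans pm (n≤1+n _))) (prefixed-B 1 k ≤-refl ≤-refl))
    (All.++⁺ (All-map-rangeDesc groupAᵏ 1 m (λ i pi qi → below (longer-run-⊏ {a} {b} refl i (suc m) (b ∷ []) [] qi)))
             (apart-B ((a ^ˢ m) ++ b ∷ []) 1 k ≤-refl))
    where
    x = (a ^ˢ (suc m)) ++ b ∷ []
    d = 4 + n ∸ suc m
    pre = ($ ∷ [] , T$ ∷ []) ∷ (a ∷ $ ∷ [] , Ta ∷ []) ∷ map groupAᵏ (rangeDesc (2 + m) d)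
    post = map groupAᵏ (rangeDesc 1 m) ++ map groupBᵏ (range 1 k)
    m+d≡4+n : suc m + d ≡ 4 + n
    m+d≡4+n = trans (+-comm (suc m) d) (m∸n+n≡m pm)
    groups≡ : groups ≡ pre ++ (x , groupA (suc m)) ∷ post
    groups≡ = cong (λ z → ($ ∷ [] , T$ ∷ []) ∷ (a ∷ $ ∷ [] , Ta ∷ []) ∷ z)
      (trans (cong (λ z → map groupAᵏ z ++ map groupBᵏ (range 1 k))
                   (trans (cong (rangeDesc 1) (sym (m∸n+n≡m pm))) (rangeDesc-++ 1 d (suc m))))
        (trans (cong (_++ map groupBᵏ (range 1 k)) (map-++ groupAᵏ (rangeDesc (2 + m) d) (rangeDesc 1 (suc m))))
          (++-assoc (map groupAᵏ (rangeDesc (2 + m) d)) _ _)))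

  βB : ∀ j → suc j ≤ k → βk k ((b ^ˢ (suc j)) ++ a ∷ []) ≡ lastLetters (groupB (suc j))
  βB j pj = β-group x pre (groupB (suc j)) post groups≡
    ((extends [] ∷ []) ∷ (extends [] ∷ []) ∷ All.++⁺ (prefixed-A 1 (4 + n) ≤-refl ≤-refl)
                                                     (prefixed-B 1 j ≤-refl (≤-trans pj (n≤1+n _))))
    (above (here refl) ∷ above (here refl) ∷
     All.++⁺ (All-map-rangeDesc groupAᵏ 1 (4 + n) λ { (suc i) pi qi → above (here refl) })
             (All-map-range groupBᵏ 1 j (λ i pi qi → above (shorter-run-⊏ {b} {a} refl i (suc j) [] (a ∷ []) qi))))
    (proj₂ (keyed-groupB (suc j) (s≤s z≤n) pj))
    (prefixed-B (2 + j) e (s≤s z≤n) (≤-reflexive (cong suc (m+[n∸m]≡n pj))))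
    (All-map-range groupBᵏ (2 + j) e (λ i pi qi → below (shorter-run-⊏ {b} {a} refl (suc j) i [] (a ∷ []) pi)))
    where
    x = (b ^ˢ (suc j)) ++ a ∷ []
    e = k ∸ suc j
    pre = ($ ∷ [] , T$ ∷ []) ∷ (a ∷ $ ∷ [] , Ta ∷ []) ∷ (map groupAᵏ (rangeDesc 1 (4 + n)) ++ map groupBᵏ (range 1 j))
    post = map groupBᵏ (range (2 + j) e)
    groups≡ : groups ≡ pre ++ (x , groupB (suc j)) ∷ post
    groups≡ = cong (λ z → ($ ∷ [] , T$ ∷ []) ∷ (a ∷ $ ∷ [] , Ta ∷ []) ∷ z)
      (trans (cong (λ z → map groupAᵏ (rangeDesc 1 (4 + n)) ++ map groupBᵏ z)
                   (trans (cong (range 1) (sym (trans (+-suc j e) (m+[n∸m]≡n pj)))) (range-++ 1 j (suc e))))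
        (trans (cong (map groupAᵏ (rangeDesc 1 (4 + n)) ++_) (map-++ groupBᵏ (range 1 j) (range (1 + j) (suc e))))
          (sym (++-assoc (map groupAᵏ (rangeDesc 1 (4 + n))) (map groupBᵏ (range 1 j)) _))))

last-snoc : ∀ (xs : Word) y → last (xs ++ y ∷ []) ≡ just y
last-snoc [] y = refl
last-snoc (x ∷ []) y = refl
last-snoc (x ∷ x′ ∷ xs) y = last-snoc (x′ ∷ xs) y

last-rotation : ∀ (e : Split) c → head (proj₂ e) ≡ just c → last (rotation e) ≡ just c
last-rotation (u , c ∷ r) .c refl =
  trans (cong last (trans (cong (u ++_) (unfold-reverse c r)) (sym (++-assoc u (reverse r) (c ∷ [])))))
        (last-snoc (u ++ reverse r) c)

LastLetterIs : Split → Sym → Set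
LastLetterIs e c = last (rotation e) ≡ just c

lastLetters-∷ : ∀ e es c → LastLetterIs e c → lastLetters (e ∷ es) ≡ c ∷ lastLetters es
lastLetters-∷ e es c h rewrite h = refl

lastLetters-++ : ∀ xs ys → lastLetters (xs ++ ys) ≡ lastLetters xs ++ lastLetters ys
lastLetters-++ xs ys = trans (cong (mapMaybe last) (map-++ rotation xs ys)) (mapMaybe-++ last (map rotation xs) (map rotation ys))

lastLetters-pointwise : ∀ {es cs} → Pointwise LastLetterIs es cs → ∀ rest → lastLetters (es ++ rest) ≡ cs ++ lastLetters rest
lastLetters-pointwise [] rest = refl
lastLetters-pointwise {e ∷ es} {c ∷ cs} (h ∷ hs) rest = trans (lastLetters-∷ e (es ++ rest) c h) (cong (c ∷_) (lastLetters-pointwise hs rest))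

lastLetters-map-range : ∀ (f : ℕ → Split) c s N → (∀ i → s ≤ i → i < s + N → LastLetterIs (f i) c) →
                        lastLetters (map f (range s N)) ≡ replicate N c
lastLetters-map-range f c s zero h = refl
lastLetters-map-range f c s (suc N) h =
  trans (lastLetters-∷ (f s) (map f (range (suc s) N)) c (h s ≤-refl (m<m+n s (s≤s z≤n))))
    (cong (c ∷_) (lastLetters-map-range f c (suc s) N (λ i p q → h i (≤-trans (n≤1+n s) p) (subst (i <_) (sym (+-suc s N)) q))))

lastLetters-map-rangeDesc : ∀ (f : ℕ → Split) c s N → (∀ i → s ≤ i → i < s + N → LastLetterIs (f i) c) →
                            lastLetters (map f (rangeDesc s N)) ≡ replicate N c
lastLetters-map-rangeDesc f c s zero h = refl
lastLetters-map-rangeDesc f c s (suc N) h =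
  trans (lastLetters-∷ (f (s + N)) (map f (rangeDesc s N)) c (h (s + N) (m≤m+n s N) (subst (s + N <_) (sym (+-suc s N)) ≤-refl)))
    (cong (c ∷_) (lastLetters-map-rangeDesc f c s N (λ i p q → h i p (≤-trans q (subst (s + N ≤_) (sym (+-suc s N)) (n≤1+n _))))))

alternate : ℕ → Sym → Sym → Word
alternate zero c d = []
alternate (suc N) c d = c ∷ d ∷ alternate N c d

lastLetters-pairs : ∀ (x y : ℕ → Split) c d s N → (∀ i → s ≤ i → i < s + N → LastLetterIs (x i) c) →
  (∀ i → s ≤ i → i < s + N → LastLetterIs (y i) d) → lastLetters (concatMap (λ i → x i ∷ y i ∷ []) (range s N)) ≡ alternate N c d
lastLetters-pairs x y c d s zero h₁ h₂ = refl
lastLetters-pairs x y c d s (suc N) h₁ h₂ =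
  trans (lastLetters-pointwise {x s ∷ y s ∷ []} (h₁ s ≤-refl (m<m+n s (s≤s z≤n)) ∷ h₂ s ≤-refl (m<m+n s (s≤s z≤n)) ∷ [])
                           (concatMap (λ i → x i ∷ y i ∷ []) (range (suc s) N)))
    (cong (λ z → c ∷ d ∷ z)
      (lastLetters-pairs x y c d (suc s) N (λ i p q → h₁ i (≤-trans (n≤1+n s) p) (subst (i <_) (sym (+-suc s N)) q))
                                           (λ i p q → h₂ i (≤-trans (n≤1+n s) p) (subst (i <_) (sym (+-suc s N)) q))))

module LastLettersOfGroups (n : ℕ) where
  open Layout n

  ∸-suc : ∀ {i m} → suc m ≤ i → i ∸ m ≡ suc (i ∸ suc m)
  ∸-suc {suc i} (s≤s p) = +-∸-assoc 1 p

  last-E₀₂ : LastLetterIs (E₀ 2) $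
  last-E₀₂ = trans (cong last (++-identityʳ (proj₁ (E₀ 2))))
                   (trans (last-∷-++ b (blocks 3 (3 + n)) a ((b ^ˢ k) ++ a ∷ $ ∷ [])) (last-∷-++ a (b ^ˢ k) a ($ ∷ [])))
    where
    last-∷-++ : ∀ (x : Sym) X y Y → last (x ∷ (X ++ y ∷ Y)) ≡ last (y ∷ Y)
    last-∷-++ x [] y Y = refl
    last-∷-++ x (x′ ∷ X) y Y = last-∷-++ x′ X y Y

  last-R-inner : ∀ i m → 3 + m ≤ i → LastLetterIs (R i m) a
  last-R-inner (suc (suc i)) m (s≤s (s≤s p)) =
    last-rotation (R (2 + i) m) a (cong (λ z → head ((a ^ˢ z) ++ revQ₂ (2 + i) (revPrefix (2 + i)))) (∸-suc p))

  last-R-first : ∀ m → LastLetterIs (R (2 + m) m) b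
  last-R-first m = last-rotation (R (2 + m) m) b (cong (λ z → head ((a ^ˢ z) ++ revQ₂ (2 + m) (revPrefix (2 + m)))) (n∸n≡0 m))

  lastLetters-Rcol : ∀ m → m ≤ n → lastLetters (groupA (4 + m)) ≡ b ∷ replicate (n ∸ m) a
  lastLetters-Rcol m pm rewrite +-∸-assoc 1 pm =
    trans (lastLetters-∷ (R (5 + m) (3 + m)) (map (λ i → R i (3 + m)) (range (6 + m) (n ∸ m))) b (last-R-first (3 + m)))
      (cong (b ∷_) (lastLetters-map-range (λ i → R i (3 + m)) a (6 + m) (n ∸ m) (λ i p q → last-R-inner i (3 + m) p)))

  lastLetters-groupA₃ : lastLetters (groupA 3) ≡ b ∷ b ∷ b ∷ b ∷ b ∷ (alternate n a b ++ a ∷ [])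
  lastLetters-groupA₃ =
    trans (lastLetters-pointwise {E₁ 2 ∷ E₁ 3 ∷ E₁ 4 ∷ R 4 2 ∷ E₁ 5 ∷ []}
             (last-rotation (E₁ 2) b refl ∷ last-rotation (E₁ 3) b refl ∷ last-rotation (E₁ 4) b refl ∷
              last-R-first 2 ∷ last-rotation (E₁ 5) b refl ∷ []) (pairsRE₁ ++ R (5 + n) 2 ∷ []))
      (cong (λ z → b ∷ b ∷ b ∷ b ∷ b ∷ z) (trans (lastLetters-++ pairsRE₁ (R (5 + n) 2 ∷ []))
        (cong₂ _++_ (lastLetters-pairs (λ i → R i 2) (λ i → E₁ (suc i)) a b 5 n (λ i p q → last-R-inner i 2 p)
                                       (λ i p q → last-rotation (E₁ (suc i)) b refl))
                    (lastLetters-pointwise {R (5 + n) 2 ∷ []} (last-R-inner (5 + n) 2 (s≤s (s≤s (s≤s (s≤s (s≤s z≤n))))) ∷ []) []))))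

  lastLetters-groupA₂ : lastLetters (groupA 2) ≡ a ∷ a ∷ b ∷ a ∷ (alternate (1 + n) a a ++ a ∷ [])
  lastLetters-groupA₂ =
    trans (lastLetters-pointwise {E₂ 2 ∷ E₂ 3 ∷ R 3 1 ∷ E₂ 4 ∷ []}
             (last-rotation (E₂ 2) a refl ∷ last-rotation (E₂ 3) a refl ∷ last-R-first 1 ∷ last-rotation (E₂ 4) a refl ∷ [])
             (pairsRE₂ ++ R (5 + n) 1 ∷ []))
      (cong (λ z → a ∷ a ∷ b ∷ a ∷ z) (trans (lastLetters-++ pairsRE₂ (R (5 + n) 1 ∷ []))
        (cong₂ _++_ (lastLetters-pairs (λ i → R i 1) (λ i → E₂ (suc i)) a a 4 (1 + n) (λ i p q → last-R-inner i 1 p)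
                                       (λ i p q → last-rotation (E₂ (suc i)) a refl))
                    (lastLetters-pointwise {R (5 + n) 1 ∷ []} (last-R-inner (5 + n) 1 (s≤s (s≤s (s≤s (s≤s z≤n)))) ∷ []) []))))

  lastLetters-groupA₁ : lastLetters (groupA 1) ≡ replicate (4 + n) b ++ $ ∷ a ∷ b ∷ a ∷ (alternate (2 + n) a a ++ a ∷ [])
  lastLetters-groupA₁ = trans (lastLetters-++ (map E₄ (rangeDesc 2 (4 + n))) rest)
    (cong₂ _++_ (lastLetters-map-rangeDesc E₄ b 2 (4 + n) (λ { (suc (suc i)) p q → last-rotation (E₄ (2 + i)) b refl ; (suc zero) (s≤s ()) q }))
      (trans (lastLetters-pointwise {E₀ 2 ∷ E₃ 2 ∷ E₀ 3 ∷ E₃ 3 ∷ []}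
                (last-E₀₂ ∷ last-rotation (E₃ 2) a refl ∷ last-rotation (E₀ 3) b refl ∷ last-rotation (E₃ 3) a refl ∷ [])
                (pairsE₀E₃ ++ T₀ ∷ []))
        (cong (λ z → $ ∷ a ∷ b ∷ a ∷ z) (trans (lastLetters-++ pairsE₀E₃ (T₀ ∷ []))
          (cong₂ _++_ (lastLetters-pairs E₀ E₃ a a 4 (2 + n) (λ { (suc (suc (suc (suc i)))) p q → last-rotation (E₀ (4 + i)) a refl
                                                         ; (suc (suc (suc zero))) (s≤s (s≤s (s≤s ()))) q
                                                         ; (suc (suc zero)) (s≤s (s≤s ())) q ; (suc zero) (s≤s ()) q })
                                         (λ i p q → last-rotation (E₃ i) a refl))
                      (lastLetters-pointwise {T₀ ∷ []} (last-rotation T₀ a refl ∷ []) []))))))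
    where
    rest = E₀ 2 ∷ E₃ 2 ∷ E₀ 3 ∷ E₃ 3 ∷ (pairsE₀E₃ ++ T₀ ∷ [])

  lastLetters-groupB₁ : lastLetters (groupB 1) ≡
    b ∷ (replicate (1 + n) a ++ b ∷ b ∷ b ∷ a ∷ (replicate (1 + n) b ++ a ∷ (replicate (4 + n) b ++ a ∷ [])))
  lastLetters-groupB₁ = trans (lastLetters-∷ (Tb 1) (E5s ++ groupB₁-tail₁) b (last-rotation (Tb 1) b refl))
    (cong (b ∷_) (trans (lastLetters-++ E5s groupB₁-tail₁)
      (cong₂ _++_ (lastLetters-map-rangeDesc E₅ a 5 (1 + n) (λ i p q → last-rotation (E₅ i) a refl)) tail₁≡)))
    where
    E5s = map E₅ (rangeDesc 5 (1 + n))
    F1s = map F₁ (range 5 (1 + n))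
    S1s = map S₁ (rangeDesc 2 (4 + n))
    tail₂≡ : lastLetters groupB₁-tail₂ ≡ a ∷ (replicate (4 + n) b ++ a ∷ [])
    tail₂≡ = trans (lastLetters-∷ (E₅ 3) (S1s ++ E₅ 2 ∷ []) a (last-rotation (E₅ 3) a refl))
      (cong (a ∷_) (trans (lastLetters-++ S1s (E₅ 2 ∷ []))
        (cong₂ _++_ (lastLetters-map-rangeDesc S₁ b 2 (4 + n) (λ { (suc (suc i)) p q → last-rotation (S₁ (2 + i)) b refl ; (suc zero) (s≤s ()) q }))
                    (lastLetters-pointwise {E₅ 2 ∷ []} (last-rotation (E₅ 2) a refl ∷ []) []))))
    tail₁≡ : lastLetters groupB₁-tail₁ ≡ b ∷ b ∷ b ∷ a ∷ (replicate (1 + n) b ++ a ∷ (replicate (4 + n) b ++ a ∷ []))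
    tail₁≡ = trans (lastLetters-pointwise {F 2 1 ∷ F 3 1 ∷ F 4 1 ∷ E₅ 4 ∷ []}
                     (last-rotation (F 2 1) b refl ∷ last-rotation (F 3 1) b refl ∷ last-rotation (F 4 1) b refl ∷
                      last-rotation (E₅ 4) a refl ∷ []) (F1s ++ groupB₁-tail₂))
      (cong (λ z → b ∷ b ∷ b ∷ a ∷ z) (trans (lastLetters-++ F1s groupB₁-tail₂)
        (cong₂ _++_ (lastLetters-map-range F₁ b 5 (1 + n) (λ { (suc (suc i)) p q → last-rotation (F₁ (2 + i)) b refl ; (suc zero) (s≤s ()) q })) tail₂≡)))

  last-F : ∀ i j → j < i → LastLetterIs (F i j) b
  last-F i j p = last-rotation (F i j) b (cong (λ z → head ((b ^ˢ z) ++ a ∷ revPrefix i)) (∸-suc p))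

  last-S : ∀ i j → j < i → LastLetterIs (S i j) b
  last-S i j p = last-rotation (S i j) b (cong (λ z → head ((b ^ˢ z) ++ revQ₁ i (revPrefix i))) (∸-suc p))

  lastLetters-groupB : ∀ j → 2 + j ≤ 5 + n →
    lastLetters (groupB (2 + j)) ≡ b ∷ a ∷ (replicate (3 + n ∸ j) b ++ (replicate (3 + n ∸ j) b ++ a ∷ []))
  lastLetters-groupB j p = go (k ∸ (2 + j)) (3 + n ∸ j) k∸j≡ (last-rotation (Tb (2 + j)) b (cong (λ z → head ((b ^ˢ z) ++ a ∷ revPrefix k)) k∸j≡))
    where
    i = 2 + j
    k∸j≡ : k ∸ (2 + j) ≡ suc (3 + n ∸ j)
    k∸j≡ = +-∸-assoc 1 (≤-pred (≤-pred p))
    go : ∀ N M → N ≡ suc M → LastLetterIs (Tb i) b →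
         lastLetters (Tb i ∷ (map (λ i′ → F i′ i) (range i N) ++ map (λ i′ → S i′ i) (rangeDesc i N))) ≡
         b ∷ a ∷ (replicate M b ++ (replicate M b ++ a ∷ []))
    go .(suc M) M refl h =
      trans (lastLetters-∷ (Tb i) (Fs ++ Ss) b h)
        (cong (b ∷_) (trans (lastLetters-++ Fs Ss)
          (cong₂ _++_ (trans (lastLetters-∷ (F i i) (map (λ i′ → F i′ i) (range (suc i) M)) a
                                (last-rotation (F i i) a (cong (λ z → head ((b ^ˢ z) ++ a ∷ revPrefix i)) (n∸n≡0 i))))
                             (cong (a ∷_) (lastLetters-map-range (λ i′ → F i′ i) b (suc i) M (λ i′ q r → last-F i′ i q))))
                      (Ss≡ M))))
      where
      Fs = map (λ i′ → F i′ i) (range i (suc M))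
      Ss = map (λ i′ → S i′ i) (rangeDesc i (suc M))
      Ss≡ : ∀ M → lastLetters (map (λ i′ → S i′ i) (rangeDesc i (suc M))) ≡ replicate M b ++ a ∷ []
      Ss≡ zero = trans (cong (λ z → lastLetters (S z i ∷ [])) (+-identityʳ i))
                       (lastLetters-∷ (S i i) [] a (last-rotation (S i i) a (cong (λ z → head ((b ^ˢ z) ++ revQ₁ i (revPrefix i))) (n∸n≡0 i))))
      Ss≡ (suc M) = trans (lastLetters-∷ (S (i + suc M) i) (map (λ i′ → S i′ i) (rangeDesc i (suc M))) b (last-S (i + suc M) i (m<m+n i (s≤s z≤n)))) (cong (b ∷_) (Ss≡ M))

  lastLetters-groupBₖ : lastLetters (groupB k) ≡ a ∷ []
  lastLetters-groupBₖ =
    trans (cong (λ N → lastLetters (Tb k ∷ (map (λ i → F i k) (range k N) ++ map (λ i → S i k) (rangeDesc k N)))) (n∸n≡0 n))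
          (lastLetters-∷ (Tb k) [] a (last-rotation (Tb k) a (cong (λ z → head ((b ^ˢ z) ++ a ∷ revPrefix k)) (n∸n≡0 n))))

-- The values of β and the runs

replicate-+ : ∀ (c : Sym) m p → replicate (m + p) c ≡ replicate m c ++ replicate p c
replicate-+ c zero p = refl
replicate-+ c (suc m) p = cong (c ∷_) (replicate-+ c m p)

alternate-same : ∀ (c : Sym) N → alternate N c c ++ c ∷ [] ≡ replicate (suc (N + N)) c
alternate-same c zero = refl
alternate-same c (suc N) =
  cong (λ z → c ∷ c ∷ z) (trans (alternate-same c N) (cong (λ m → replicate m c) (sym (+-suc N N))))

alternate-∏ : ∀ (c d : Sym) N (g : ℕ → ℕ) → alternate N c d ≡ concatMap (λ _ → c ∷ d ∷ []) (applyUpTo g N)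
alternate-∏ c d zero g = refl
alternate-∏ c d (suc N) g = cong (λ z → c ∷ d ∷ z) (alternate-∏ c d N (λ x → g (suc x)))

∏-range : ∀ (f : ℕ → Word) s N → concatMap (λ j → f (s + j)) (upTo N) ≡ concatMap f (range s N)
∏-range f s N = trans (cong concat (map-applyUpTo (λ x → x) (λ j → f (s + j)) N)) (go s N)
  where
  go : ∀ s N → concat (applyUpTo (λ j → f (s + j)) N) ≡ concatMap f (range s N)
  go s zero = refl
  go s (suc N) = cong₂ _++_ (cong f (+-identityʳ s))
    (trans (cong concat (applyUpTo-cong _ _ N (λ j → cong f (+-suc s j)))) (go (suc s) N))

module BetaValues (n : ℕ) where
  open Layout n
  open Beta n
  open LastLettersOfGroups n

  β-$ : βk k ($ ∷ []) ≡ a ∷ []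
  β-$ = trans β$ (lastLetters-pointwise {T$ ∷ []} (last-rotation T$ a refl ∷ []) [])

  β-a$ : βk k (a ∷ $ ∷ []) ≡ b ∷ []
  β-a$ = trans βa$ (lastLetters-pointwise {Ta ∷ []} (last-rotation Ta b refl ∷ []) [])

  β-aⁱb : ∀ i → 4 ≤ i → i ≤ k ∸ 2 → βk k ((a ^ˢ i) ++ (b ∷ [])) ≡ b ∷ (a ^ˢ (k ∸ i ∸ 2))
  β-aⁱb (suc zero) (s≤s ()) q
  β-aⁱb (suc (suc zero)) (s≤s (s≤s ())) q
  β-aⁱb (suc (suc (suc zero))) (s≤s (s≤s (s≤s ()))) q
  β-aⁱb (suc (suc (suc (suc m)))) p q = begin
      βk k ((a ^ˢ (4 + m)) ++ b ∷ [])  ≡⟨ βA (3 + m) q ⟩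
      lastLetters (groupA (4 + m))     ≡⟨ lastLetters-Rcol m m≤n ⟩
      b ∷ (a ^ˢ (n ∸ m))               ≡⟨ cong (λ z → b ∷ (a ^ˢ z)) (sym (cong (_∸ 2) (+-∸-assoc 2 m≤n))) ⟩
      b ∷ (a ^ˢ (k ∸ (4 + m) ∸ 2))     ∎
    where
    open ≡-Reasoning
    m≤n : m ≤ n
    m≤n = ≤-pred (≤-pred (≤-pred (≤-pred q)))

  β-a³b : βk k ((a ^ˢ 3) ++ (b ∷ [])) ≡ (b ^ˢ 5) ++ ∏[ 1 ⋯ k ∸ 6 ] (λ _ → a ∷ b ∷ []) ++ (a ∷ [])
  β-a³b = trans (βA 2 (s≤s (s≤s (s≤s z≤n)))) (trans lastLetters-groupA₃
    (cong (λ z → b ∷ b ∷ b ∷ b ∷ b ∷ (z ++ a ∷ [])) (alternate-∏ a b n (λ x → x))))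

  2k≡ : 2 * k ≡ 12 + (n + n)
  2k≡ = double n
    where
    double : ∀ n → 2 * (6 + n) ≡ 12 + (n + n)
    double = solve-∀

  β-a²b : βk k ((a ^ˢ 2) ++ (b ∷ [])) ≡ a ∷ a ∷ b ∷ (a ^ˢ (2 * k ∸ 8))
  β-a²b = trans (βA 1 (s≤s (s≤s z≤n))) (trans lastLetters-groupA₂ (cong (λ z → a ∷ a ∷ b ∷ z)
    (trans (cong (a ∷_) (alternate-same a (1 + n))) (cong (λ m → replicate m a) count))))
    where
    count : 2 + ((1 + n) + (1 + n)) ≡ 2 * k ∸ 8
    count = trans (regroup n) (sym (trans (cong (_∸ 8) 2k≡) (m+n∸m≡n 8 (4 + (n + n)))))
      where
      regroup : ∀ n → 2 + ((1 + n) + (1 + n)) ≡ 4 + (n + n)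
      regroup = solve-∀

  β-ab : βk k (a ∷ b ∷ []) ≡ (b ^ˢ (k ∸ 2)) ++ $ ∷ a ∷ b ∷ (a ^ˢ (2 * k ∸ 6))
  β-ab = trans (βA 0 (s≤s z≤n)) (trans lastLetters-groupA₁ (cong (λ z → replicate (4 + n) b ++ $ ∷ a ∷ b ∷ z)
    (trans (cong (a ∷_) (alternate-same a (2 + n))) (cong (λ m → replicate m a) count))))
    where
    count : 2 + ((2 + n) + (2 + n)) ≡ 2 * k ∸ 6
    count = trans (regroup n) (sym (trans (cong (_∸ 6) 2k≡) (m+n∸m≡n 6 (6 + (n + n)))))
      where
      regroup : ∀ n → 2 + ((2 + n) + (2 + n)) ≡ 6 + (n + n)
      regroup = solve-∀

  β-ba : βk k (b ∷ a ∷ []) ≡ b ∷ (a ^ˢ (k ∸ 5)) ++ b ∷ b ∷ b ∷ a ∷ (b ^ˢ (k ∸ 5)) ++ a ∷ (b ^ˢ (k ∸ 2)) ++ (a ∷ [])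
  β-ba = trans (βB 0 (s≤s z≤n)) lastLetters-groupB₁

  β-bʲa : ∀ j → 2 ≤ j → j ≤ k ∸ 1 → βk k ((b ^ˢ j) ++ (a ∷ [])) ≡ b ∷ a ∷ (b ^ˢ (2 * k ∸ 2 * j ∸ 2)) ++ (a ∷ [])
  β-bʲa (suc zero) (s≤s ()) q
  β-bʲa (suc (suc j)) p q = begin
      βk k ((b ^ˢ (2 + j)) ++ a ∷ [])                     ≡⟨ βB (1 + j) (≤-trans q (n≤1+n _)) ⟩
      lastLetters (groupB (2 + j))                          ≡⟨ lastLetters-groupB j q ⟩
      b ∷ a ∷ ((b ^ˢ M) ++ ((b ^ˢ M) ++ a ∷ []))            ≡⟨ cong (λ z → b ∷ a ∷ z) (sym (++-assoc (b ^ˢ M) (b ^ˢ M) (a ∷ []))) ⟩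
      b ∷ a ∷ (((b ^ˢ M) ++ (b ^ˢ M)) ++ a ∷ [])            ≡⟨ cong (λ z → b ∷ a ∷ z ++ a ∷ []) (sym (replicate-+ b M M)) ⟩
      b ∷ a ∷ (b ^ˢ (M + M)) ++ a ∷ []                      ≡⟨ cong (λ m → b ∷ a ∷ (b ^ˢ m) ++ a ∷ []) (sym count) ⟩
      b ∷ a ∷ (b ^ˢ (2 * k ∸ 2 * (2 + j) ∸ 2)) ++ a ∷ []    ∎
    where
    open ≡-Reasoning
    M = 3 + n ∸ j
    regroup : ∀ j M → 2 * (3 + (j + M)) ≡ 2 * (2 + j) + (2 + (M + M))
    regroup = solve-∀
    count : 2 * k ∸ 2 * (2 + j) ∸ 2 ≡ M + M
    count = cong (_∸ 2) (trans (cong (λ z → 2 * (3 + z) ∸ 2 * (2 + j)) (sym (m+[n∸m]≡n (≤-pred (≤-pred q)))))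
                               (trans (cong (_∸ 2 * (2 + j)) (regroup j M)) (m+n∸m≡n (2 * (2 + j)) (2 + (M + M)))))

  β-bᵏa : βk k ((b ^ˢ k) ++ (a ∷ [])) ≡ a ∷ []
  β-bᵏa = trans (βB (5 + n) ≤-refl) lastLetters-groupBₖ

lastLetters-concatMap : ∀ {X : Set} (g : X → List Split) xs → lastLetters (concatMap g xs) ≡ concatMap (λ x → lastLetters (g x)) xs
lastLetters-concatMap g [] = refl
lastLetters-concatMap g (x ∷ xs) = trans (lastLetters-++ (g x) _) (cong (lastLetters (g x) ++_) (lastLetters-concatMap g xs))

runsFrom-replicate : ∀ c m Y → runsFrom c (replicate m c ++ Y) ≡ runsFrom c Y
runsFrom-replicate c zero Y = refl
runsFrom-replicate c (suc m) Y rewrite ==ˢ-refl c = runsFrom-replicate c m Y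

runsFrom-replicate-++ : ∀ c m T Y → runsFrom c ((replicate m c ++ T) ++ Y) ≡ runsFrom c (T ++ Y)
runsFrom-replicate-++ c m T Y = trans (cong (runsFrom c) (++-assoc (replicate m c) T Y)) (runsFrom-replicate c m (T ++ Y))

runsFrom-alternate-ab : ∀ N Y → runsFrom b (alternate N a b ++ Y) ≡ (N + N) + runsFrom b Y
runsFrom-alternate-ab zero Y = refl
runsFrom-alternate-ab (suc N) Y =
  trans (cong (λ z → suc (suc z)) (runsFrom-alternate-ab N Y)) (cong suc (cong (_+ runsFrom b Y) (sym (+-suc N N))))

runsFrom-alternate-aa : ∀ N Y → runsFrom a (alternate N a a ++ Y) ≡ runsFrom a Y
runsFrom-alternate-aa zero Y = refl
runsFrom-alternate-aa (suc N) Y = runsFrom-alternate-aa N Y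

staircase : ℕ → Word
staircase N = concatMap (λ s → b ∷ replicate s a) (range 0 (suc N))

runsFrom-staircase : ∀ N Y → runsFrom b (staircase N ++ b ∷ Y) ≡ (N + N) + runsFrom b Y
runsFrom-staircase zero Y = refl
runsFrom-staircase (suc N) Y =
  begin
    runsFrom b (staircase (suc N) ++ b ∷ Y)
  ≡⟨ cong (λ z → runsFrom b (z ++ b ∷ Y)) (trans (cong (concatMap step) (range-snoc 0 (suc N)))
                                                 (concatMap-++ step (range 0 (suc N)) (suc N ∷ []))) ⟩
    runsFrom b ((staircase N ++ step (suc N) ++ []) ++ b ∷ Y)
  ≡⟨ cong (runsFrom b) (++-assoc (staircase N) (step (suc N) ++ []) (b ∷ Y)) ⟩
    runsFrom b (staircase N ++ b ∷ a ∷ ((replicate N a ++ []) ++ b ∷ Y))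
  ≡⟨ runsFrom-staircase N (a ∷ ((replicate N a ++ []) ++ b ∷ Y)) ⟩
    (N + N) + suc (runsFrom a ((replicate N a ++ []) ++ b ∷ Y))
  ≡⟨ cong (λ z → (N + N) + suc z) (runsFrom-replicate-++ a N [] (b ∷ Y)) ⟩
    (N + N) + suc (suc (runsFrom b Y))
  ≡⟨ regroup N (runsFrom b Y) ⟩
    (suc N + suc N) + runsFrom b Y
  ∎
  where
  open ≡-Reasoning
  step = λ s → b ∷ replicate s a
  regroup : ∀ N r → (N + N) + suc (suc r) ≡ (suc N + suc N) + r
  regroup = solve-∀

runsFrom-concatMap-range : ∀ (f : ℕ → Word) c s N m → (∀ i → s ≤ i → i < s + N → ∀ Y → runsFrom c (f i ++ Y) ≡ m + runsFrom c Y) →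
  ∀ Y → runsFrom c (concatMap f (range s N) ++ Y) ≡ N * m + runsFrom c Y
runsFrom-concatMap-range f c s zero m h Y = refl
runsFrom-concatMap-range f c s (suc N) m h Y =
  trans (cong (runsFrom c) (++-assoc (f s) _ Y))
    (trans (h s ≤-refl (m<m+n s (s≤s z≤n)) _)
      (trans (cong (m +_) (runsFrom-concatMap-range f c (suc s) N m
                             (λ i p q → h i (≤-trans (n≤1+n s) p) (subst (i <_) (sym (+-suc s N)) q)) Y))
             (sym (+-assoc m (N * m) _))))

module BWTValue (n : ℕ) where
  open Layout n
  open Beta n
  open BetaValues n
  open LastLettersOfGroups n

  lettersA lettersB : Word
  lettersA = concatMap (λ m → lastLetters (groupA m)) (rangeDesc 1 (4 + n))
  lettersB = concatMap (λ j → lastLetters (groupB j)) (range 1 k)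

  BWT-groups : BWT (w$ k) ≡ a ∷ b ∷ (lettersA ++ lettersB)
  BWT-groups =
    trans (cong (mapMaybe last) (SortedConjugates.sortedConjugates-w$ n))
      (trans (lastLetters-pointwise {T$ ∷ Ta ∷ []} (last-rotation T$ a refl ∷ last-rotation Ta b refl ∷ [])
                                    (concatMap groupA (rangeDesc 1 (4 + n)) ++ concatMap groupB (range 1 k)))
        (cong (λ z → a ∷ b ∷ z)
          (trans (lastLetters-++ (concatMap groupA (rangeDesc 1 (4 + n))) (concatMap groupB (range 1 k)))
                 (cong₂ _++_ (lastLetters-concatMap groupA (rangeDesc 1 (4 + n))) (lastLetters-concatMap groupB (range 1 k))))))

  BWT-β : BWT (w$ k) ≡ βk k ($ ∷ []) ++ βk k (a ∷ $ ∷ [])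
                       ++ ∏[ 2 ⋯ k ∸ 1 ] (λ i → βk k ((a ^ˢ (k ∸ i)) ++ (b ∷ [])))
                       ++ ∏[ 1 ⋯ k ] (λ i → βk k ((b ^ˢ i) ++ (a ∷ [])))
  BWT-β = trans BWT-groups (sym (cong₂ _++_ β-$ (cong₂ _++_ β-a$ (cong₂ _++_ ∏A ∏B))))
    where
    βA′ : ∀ m → 1 ≤ m → m < 1 + (4 + n) → βk k ((a ^ˢ m) ++ b ∷ []) ≡ lastLetters (groupA m)
    βA′ (suc m) p q = βA m (≤-pred q)
    βB′ : ∀ j → 1 ≤ j → j < 1 + k → βk k ((b ^ˢ j) ++ a ∷ []) ≡ lastLetters (groupB j)
    βB′ (suc j) p q = βB j (≤-pred q)
    ∏A : ∏[ 2 ⋯ k ∸ 1 ] (λ i → βk k ((a ^ˢ (k ∸ i)) ++ (b ∷ []))) ≡ lettersA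
    ∏A = trans (∏-range (λ i → βk k ((a ^ˢ (k ∸ i)) ++ (b ∷ []))) 2 (4 + n))
      (trans (concatMap-range-∸ (λ m → βk k ((a ^ˢ m) ++ b ∷ [])) k (4 + n) 2 1 (cong (λ z → 5 + z) (+-comm n 2)))
        (concatMap-cong-rangeDesc 1 (4 + n) βA′))
    ∏B : ∏[ 1 ⋯ k ] (λ i → βk k ((b ^ˢ i) ++ (a ∷ []))) ≡ lettersB
    ∏B = trans (∏-range (λ i → βk k ((b ^ˢ i) ++ (a ∷ []))) 1 k) (concatMap-cong-range 1 k βB′)

  wA₃ wA₂ wA₁ wB₁ : Word
  wA₃ = b ∷ b ∷ b ∷ b ∷ b ∷ (alternate n a b ++ a ∷ [])
  wA₂ = a ∷ a ∷ b ∷ a ∷ (alternate (1 + n) a a ++ a ∷ [])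
  wA₁ = replicate (4 + n) b ++ $ ∷ a ∷ b ∷ a ∷ (alternate (2 + n) a a ++ a ∷ [])
  wB₁ = b ∷ (replicate (1 + n) a ++ b ∷ b ∷ b ∷ a ∷ (replicate (1 + n) b ++ a ∷ (replicate (4 + n) b ++ a ∷ [])))

  lettersA-split : lettersA ≡ staircase n ++ (wA₃ ++ (wA₂ ++ (wA₁ ++ [])))
  lettersA-split =
    trans (cong (λ m → concatMap L (rangeDesc 1 m)) (+-comm 3 (1 + n)))
      (trans (cong (concatMap L) (rangeDesc-++ 1 (1 + n) 3))
        (trans (concatMap-++ L (rangeDesc 4 (1 + n)) (3 ∷ 2 ∷ 1 ∷ []))
          (cong₂ _++_ staircase≡ (cong₂ _++_ lastLetters-groupA₃ (cong₂ _++_ lastLetters-groupA₂ (cong₂ _++_ lastLetters-groupA₁ refl))))))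
    where
    L = λ m → lastLetters (groupA m)
    step = λ t → b ∷ replicate (n ∸ t) a
    L≡ : ∀ t → 0 ≤ t → t < 0 + (1 + n) → L (4 + t) ≡ step t
    L≡ t p q = lastLetters-Rcol t (≤-pred q)
    staircase≡ : concatMap L (rangeDesc 4 (1 + n)) ≡ staircase n
    staircase≡ =
      trans (concatMap-rangeDesc-+ L 4 0 (1 + n))
        (trans (concatMap-cong-rangeDesc 0 (1 + n) L≡)
          (trans (sym (concatMap-range-∸ step n (1 + n) 0 0 (+-identityʳ (suc n))))
                 (concatMap-cong-range 0 (1 + n) (λ i p q → cong (λ z → b ∷ replicate z a) (m∸[m∸n]≡n (≤-pred q))))))

  runs-A₃ : ∀ Y → runsFrom b (staircase n ++ (wA₃ ++ Y)) ≡ (n + n) + ((n + n) + suc (runsFrom a Y))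
  runs-A₃ Y = trans (runsFrom-staircase n _)
    (cong ((n + n) +_) (trans (cong (runsFrom b) (++-assoc (alternate n a b) (a ∷ []) Y)) (runsFrom-alternate-ab n (a ∷ Y))))

  runs-A₂ : ∀ Y → runsFrom a (wA₂ ++ Y) ≡ 2 + runsFrom a Y
  runs-A₂ Y = cong (λ z → suc (suc z))
    (trans (cong (runsFrom a) (++-assoc (alternate (1 + n) a a) (a ∷ []) Y)) (runsFrom-alternate-aa (1 + n) (a ∷ Y)))

  runs-A₁ : ∀ Y → runsFrom a (wA₁ ++ Y) ≡ 5 + runsFrom a Y
  runs-A₁ Y = cong suc (trans (runsFrom-replicate-++ b (3 + n) _ Y)
    (cong (λ z → suc (suc (suc (suc z))))
      (trans (cong (runsFrom a) (++-assoc (alternate (2 + n) a a) (a ∷ []) Y)) (runsFrom-alternate-aa (2 + n) (a ∷ Y)))))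

  runs-B₁ : ∀ Y → runsFrom a (wB₁ ++ Y) ≡ 8 + runsFrom a Y
  runs-B₁ Y =
    cong suc (trans (cong (runsFrom b) (++-assoc (replicate (1 + n) a) T₁ Y))
    (cong suc (trans (runsFrom-replicate a n (T₁ ++ Y))
    (cong (λ z → suc (suc z)) (trans (cong (runsFrom a) (++-assoc (replicate (1 + n) b) T₂ Y))
    (cong suc (trans (runsFrom-replicate b n (T₂ ++ Y))
    (cong suc (trans (cong (runsFrom a) (++-assoc (replicate (4 + n) b) (a ∷ []) Y))
    (cong suc (runsFrom-replicate b (3 + n) (a ∷ Y))))))))))))
    where
    T₂ = a ∷ (replicate (4 + n) b ++ a ∷ [])
    T₁ = b ∷ b ∷ b ∷ a ∷ (replicate (1 + n) b ++ T₂)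

  runs-B : ∀ M Y → runsFrom a ((b ∷ a ∷ (replicate (suc M) b ++ (replicate (suc M) b ++ a ∷ []))) ++ Y) ≡ 4 + runsFrom a Y
  runs-B M Y = cong (λ z → suc (suc (suc z)))
    (trans (runsFrom-replicate-++ b M _ Y) (runsFrom-replicate-++ b (suc M) (a ∷ []) Y))

  runs-lettersB : runsFrom a lettersB ≡ 8 + ((3 + n) * 4 + (2 + 0))
  runs-lettersB =
    begin
      runsFrom a (lastLetters (groupB 1) ++ concatMap L (range 2 (5 + n)))
    ≡⟨ cong (λ w → runsFrom a (w ++ concatMap L (range 2 (5 + n)))) lastLetters-groupB₁ ⟩
      runsFrom a (wB₁ ++ concatMap L (range 2 (5 + n)))
    ≡⟨ runs-B₁ _ ⟩
      8 + runsFrom a (concatMap L (range 2 (5 + n)))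
    ≡⟨ cong (λ z → 8 + runsFrom a z) (trans (cong (concatMap L) (trans (cong (range 2) (+-comm 2 (3 + n))) (range-++ 2 (3 + n) 2)))
                                          (concatMap-++ L (range 2 (3 + n)) ((5 + n) ∷ (6 + n) ∷ []))) ⟩
      8 + runsFrom a (concatMap L (range 2 (3 + n)) ++ (L (5 + n) ++ L k ++ []))
    ≡⟨ cong (8 +_) (runsFrom-concatMap-range L a 2 (3 + n) 4 runs-middle _) ⟩
      8 + ((3 + n) * 4 + runsFrom a (L (5 + n) ++ L k ++ []))
    ≡⟨ cong (λ z → 8 + ((3 + n) * 4 + z)) (trans (runs-B₅ _) (cong (λ w → 2 + runsFrom a (w ++ [])) lastLetters-groupBₖ)) ⟩
      8 + ((3 + n) * 4 + (2 + 0))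
    ∎
    where
    open ≡-Reasoning
    L = λ j → lastLetters (groupB j)
    runs-middle : ∀ j → 2 ≤ j → j < 2 + (3 + n) → ∀ Y → runsFrom a (L j ++ Y) ≡ 4 + runsFrom a Y
    runs-middle (suc zero) (s≤s ()) q Y
    runs-middle (suc (suc j)) p q Y =
      trans (cong (λ w → runsFrom a (w ++ Y))
                  (trans (lastLetters-groupB j (≤-trans (n≤1+n _) q))
                         (cong (λ M → b ∷ a ∷ (replicate M b ++ (replicate M b ++ a ∷ []))) (+-∸-assoc 1 (≤-pred (≤-pred (≤-pred q)))))))
            (runs-B (2 + n ∸ j) Y)
    runs-B₅ : ∀ Y → runsFrom a (L (5 + n) ++ Y) ≡ 2 + runsFrom a Y
    runs-B₅ Y = cong (λ w → runsFrom a (w ++ Y))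
      (trans (lastLetters-groupB (3 + n) ≤-refl)
             (cong (λ M → b ∷ a ∷ (replicate M b ++ (replicate M b ++ a ∷ []))) (n∸n≡0 (3 + n))))

  runs-BWT : runs (BWT (w$ k)) ≡ 8 * k ∸ 16
  runs-BWT =
    begin
      runs (BWT (w$ k))
    ≡⟨ cong runs BWT-groups ⟩
      2 + runsFrom b (lettersA ++ lettersB)
    ≡⟨ cong (λ z → 2 + runsFrom b (z ++ lettersB)) lettersA-split ⟩
      2 + runsFrom b ((staircase n ++ (wA₃ ++ (wA₂ ++ (wA₁ ++ [])))) ++ lettersB)
    ≡⟨ cong (λ z → 2 + runsFrom b z) (reassoc (staircase n) wA₃ wA₂ wA₁ lettersB) ⟩
      2 + runsFrom b (staircase n ++ (wA₃ ++ (wA₂ ++ (wA₁ ++ lettersB))))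
    ≡⟨ cong (2 +_) (runs-A₃ _) ⟩
      2 + ((n + n) + ((n + n) + suc (runsFrom a (wA₂ ++ (wA₁ ++ lettersB)))))
    ≡⟨ cong (λ z → 2 + ((n + n) + ((n + n) + suc z)))
            (trans (runs-A₂ _) (cong (2 +_) (trans (runs-A₁ lettersB) (cong (5 +_) runs-lettersB)))) ⟩
      2 + ((n + n) + ((n + n) + suc (2 + (5 + (8 + ((3 + n) * 4 + (2 + 0)))))))
    ≡⟨ count n ⟩
      8 * k ∸ 16
    ∎
    where
    open ≡-Reasoning
    reassoc : ∀ (p q r s t : Word) → (p ++ (q ++ (r ++ (s ++ [])))) ++ t ≡ p ++ (q ++ (r ++ (s ++ t)))
    reassoc p q r s t =
      trans (++-assoc p _ t) (cong (p ++_) (trans (++-assoc q _ t) (cong (q ++_) (trans (++-assoc r _ t) (cong (r ++_) (++-assoc s [] t))))))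
    total : ∀ n → 2 + ((n + n) + ((n + n) + suc (2 + (5 + (8 + ((3 + n) * 4 + (2 + 0))))))) ≡ 32 + 8 * n
    total = solve-∀
    8k : ∀ n → 8 * (6 + n) ≡ 16 + (32 + 8 * n)
    8k = solve-∀
    count : ∀ n → 2 + ((n + n) + ((n + n) + suc (2 + (5 + (8 + ((3 + n) * 4 + (2 + 0))))))) ≡ 8 * (6 + n) ∸ 16
    count n = trans (total n) (sym (trans (cong (_∸ 16) (8k n)) (m+n∸m≡n 16 (32 + 8 * n))))

lemma21 : (k : ℕ) → 5 < k →
  (βk k ($ ∷ []) ≡ a ∷ [])
  × (βk k (a ∷ $ ∷ []) ≡ b ∷ [])
  × (∀ i → 4 ≤ i → i ≤ k ∸ 2 → βk k ((a ^ˢ i) ++ (b ∷ [])) ≡ b ∷ (a ^ˢ (k ∸ i ∸ 2)))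
  × (βk k ((a ^ˢ 3) ++ (b ∷ [])) ≡ (b ^ˢ 5) ++ ∏[ 1 ⋯ k ∸ 6 ] (λ _ → a ∷ b ∷ []) ++ (a ∷ []))
  × (βk k ((a ^ˢ 2) ++ (b ∷ [])) ≡ a ∷ a ∷ b ∷ (a ^ˢ (2 * k ∸ 8)))
  × (βk k (a ∷ b ∷ []) ≡ (b ^ˢ (k ∸ 2)) ++ $ ∷ a ∷ b ∷ (a ^ˢ (2 * k ∸ 6)))
  × (βk k (b ∷ a ∷ []) ≡ b ∷ (a ^ˢ (k ∸ 5)) ++ b ∷ b ∷ b ∷ a ∷ (b ^ˢ (k ∸ 5)) ++ a ∷ (b ^ˢ (k ∸ 2)) ++ (a ∷ []))
  × (∀ j → 2 ≤ j → j ≤ k ∸ 1 → βk k ((b ^ˢ j) ++ (a ∷ [])) ≡ b ∷ a ∷ (b ^ˢ (2 * k ∸ 2 * j ∸ 2)) ++ (a ∷ []))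
  × (βk k ((b ^ˢ k) ++ (a ∷ [])) ≡ a ∷ [])
  × (BWT (w$ k) ≡ βk k ($ ∷ []) ++ βk k (a ∷ $ ∷ [])
                   ++ ∏[ 2 ⋯ k ∸ 1 ] (λ i → βk k ((a ^ˢ (k ∸ i)) ++ (b ∷ [])))
                   ++ ∏[ 1 ⋯ k ] (λ i → βk k ((b ^ˢ i) ++ (a ∷ []))))
  × (runs (BWT (w$ k)) ≡ 8 * k ∸ 16)
lemma21 _ (s≤s (s≤s (s≤s (s≤s (s≤s (s≤s (z≤n {n}))))))) =
  β-$ , β-a$ , β-aⁱb , β-a³b , β-a²b , β-ab , β-ba , β-bʲa , β-bᵏa , BWT-β , runs-BWT
  where
  open BetaValues n
  open BWTValue n
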